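{- Let $n\ge 6$ and $\pi=(5,4^i,3^j,2^k,1^{n-i-j-k-1})$ with $i,j,k\ge 0$, $i+j\ge 5$, and $\sigma(\pi)$ even. Then $\pi$ is potentially $K_6-C_5$-graphic if and only if $\pi$ is none of $(5,3^5,2)$, $(5,3^5,2^2)$, $(5,3^7)$, $(5,3^6,1)$, $(5,3^6,2,1)$, $(5,3^7,2)$, $(5,3^8,1)$, $(5,3^7,1^2)$, $(5,4,3^5)$, $(5,4,3^5,2)$, $(5,4,3^7)$, $(5,4,3^6,1)$, $(5,4^2,3^5)$.
   Context: A non-increasing sequence of nonnegative integers is potentially $H$-graphic if some simple graph with that degree sequence contains $H$ as a subgraph. $\sigma(\pi)$ is the sum of the terms of $\pi$. $r^t$ denotes $t$ terms equal to $r$. $K_6-C_5$ denotes $K_6$ with the edges of a 5-cycle on five of its vertices removed. -}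

module Defs where

open import Data.Nat using (ℕ; zero; suc; _+_; _∸_; _≤_)
open import Data.Nat.Divisibility using (_∣_)
open import Data.Bool using (Bool; true; false; if_then_else_; _∨_)
open import Data.Fin using (Fin; toℕ)
open import Data.List using (List; []; _∷_; _++_; replicate; map; allFin; length; lookup)
open import Data.Nat.ListAction using (sum)
open import Data.Product using (Σ; _×_; ∃)
open import Relation.Nullary using (¬_)
open import Relation.Binary.PropositionalEquality using (_≡_; _≢_)
open import Function.Definitions using (Injective)

record Graph (n : ℕ) : Set where
  field
    adj    : Fin n → Fin n → Bool
    sym    : ∀ u v → adj u v ≡ adj v u
    irrefl : ∀ v → adj v v ≡ false
open Graph public

degree : ∀ {n} → Graph n → Fin n → ℕ
degree {n} G v = sum (map (λ u → if adj G v u then 1 else 0) (allFin n))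

HasDegreeSequence : (π : List ℕ) → Graph (length π) → Set
HasDegreeSequence π G = ∀ v → degree G v ≡ lookup π v

c5edge : ℕ → ℕ → Bool
c5edge 1 2 = true
c5edge 2 3 = true
c5edge 3 4 = true
c5edge 4 5 = true
c5edge 5 1 = true
c5edge _ _ = false

K6-C5-edge : Fin 6 → Fin 6 → Set
K6-C5-edge a b = (a ≢ b) × (c5edge (toℕ a) (toℕ b) ∨ c5edge (toℕ b) (toℕ a) ≡ false)

ContainsK6-C5 : ∀ {n} → Graph n → Set
ContainsK6-C5 {n} G =
  Σ (Fin 6 → Fin n) λ f → Injective _≡_ _≡_ f ×
    (∀ a b → K6-C5-edge a b → adj G (f a) (f b) ≡ true)

PotentiallyK6-C5-Graphic : List ℕ → Set
PotentiallyK6-C5-Graphic π =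
  Σ (Graph (length π)) λ G → HasDegreeSequence π G × ContainsK6-C5 G

seqπ : ℕ → ℕ → ℕ → ℕ → List ℕ
seqπ n i j k = 5 ∷ replicate i 4 ++ replicate j 3 ++ replicate k 2 ++ replicate (n ∸ i ∸ j ∸ k ∸ 1) 1

exceptions : List (List ℕ)
exceptions =
    (5 ∷ replicate 5 3 ++ 2 ∷ [])
  ∷ (5 ∷ replicate 5 3 ++ replicate 2 2)
  ∷ (5 ∷ replicate 7 3)
  ∷ (5 ∷ replicate 6 3 ++ 1 ∷ [])
  ∷ (5 ∷ replicate 6 3 ++ 2 ∷ 1 ∷ [])
  ∷ (5 ∷ replicate 7 3 ++ 2 ∷ [])
  ∷ (5 ∷ replicate 8 3 ++ 1 ∷ [])
  ∷ (5 ∷ replicate 7 3 ++ replicate 2 1)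
  ∷ (5 ∷ 4 ∷ replicate 5 3)
  ∷ (5 ∷ 4 ∷ replicate 5 3 ++ 2 ∷ [])
  ∷ (5 ∷ 4 ∷ replicate 7 3)
  ∷ (5 ∷ 4 ∷ replicate 6 3 ++ 1 ∷ [])
  ∷ (5 ∷ replicate 2 4 ++ replicate 5 3)
  ∷ []

-- Sufficiency: a sequence (5, 4^i, 3^j, 2^k, 1^m) grows from a smaller one by adding, on the new
-- vertices of degree r, a disjoint r-regular graph, so finitely many base sequences realised explicitly
-- (with K₆ − C₅ on their first six vertices) generate all of them. Adding copies of K_{r+1} makes
-- potential graphicity periodic in each count, which leaves a finite box of cases, checked by evaluation.
-- Necessity: for an exceptional sequence, fix any copy of K₆ − C₅. Its edges are forced, a vertex whose
-- degree they exhaust admits no other edge, a vertex whose remaining candidates are exactly enough must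
-- take them all, and after these two rounds some degree is violated. Up to the dihedral symmetry of the
-- removed 5-cycle only canonical copies need to be enumerated.

module Submission where

open import Defs
open import Data.Bool.Base using (Bool; true; false; T; not; _∧_; _∨_; if_then_else_)
open import Data.Bool.ListAction using (all; any)
open import Data.Bool.Properties using (T-∧; T-∨; T-≡; T-not-≡; ∧-comm; ∨-comm; ∧-zeroʳ; ∧-identityʳ; ∨-zeroʳ)
import Data.Bool.Properties as Bool
open import Data.Empty using (⊥)
open import Data.Fin.Base using (Fin; zero; suc; toℕ; inject≤)
open import Data.Fin.Properties using (toℕ-injective; toℕ-inject≤; inject≤-injective)
import Data.Fin.Properties as Fin
open import Data.List.Base using (List; []; _∷_; _++_; length; lookup; replicate; tabulate; allFin; filterᵇ; upTo)
open import Data.List.Extrema.Nat using (argmin; f[argmin]≤f[xs])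
open import Data.List.Membership.Propositional using (_∈_; _∉_)
open import Data.List.Membership.Propositional.Properties using (∈-allFin; ∈-filter⁺; ∈-upTo⁺)
import Data.List.Properties
open import Data.List.Properties using (map-tabulate; ++-assoc; ++-identityʳ; length-replicate)
open import Data.List.Relation.Unary.All using (All; []; _∷_)
import Data.List.Relation.Unary.All as All
open import Data.List.Relation.Unary.All.Properties using (all⁺; all⁻)
open import Data.List.Relation.Unary.Any using (Any; satisfied)
import Data.List.Relation.Unary.Any as Any
open import Data.List.Relation.Unary.Any.Properties using (any⁻)
open import Data.Maybe using (to-witness-T)
open import Data.Maybe.Base using (Maybe; just; nothing; _>>=_; is-just)
import Data.Maybe.Base as Maybe
open import Data.Nat.Base using (ℕ; zero; suc; _+_; _*_; _∸_; _≤_; _<_; z≤n; s≤s; _≡ᵇ_; _≤ᵇ_; _<ᵇ_; _%_; _/_; NonZero)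
open import Data.Nat.DivMod using (m≡m%n+[m/n]*n; m%n<n)
open import Data.Nat.Divisibility using (_∣_; _∣?_; ∣m+n∣m⇒∣n; m∣m*n)
open import Data.Nat.ListAction using (sum)
open import Data.Nat.ListAction.Properties using (sum-++)
import Data.Nat.Properties
open import Data.Nat.Properties
  using ( module ≤-Reasoning; +-assoc; +-identityʳ; +-commutativeSemigroup; +-mono-≤; +-mono-≤-<; +-monoʳ-<
        ; ≤-refl; ≤-trans; m≤m+n; m≤n+m; ≮⇒≥; ≤⇒≯; ≤∧≢⇒<; <-cmp; _<?_; _≤?_; m∸n+n≡m; suc-injective
        ; ≡ᵇ⇒≡; ≡⇒≡ᵇ; ≤ᵇ⇒≤; ≤⇒≤ᵇ; <ᵇ⇒<; <⇒<ᵇ)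
open import Data.Nat.Tactic.RingSolver using (solve-∀)
open import Algebra.Properties.CommutativeSemigroup +-commutativeSemigroup using (x∙yz≈y∙xz)
open import Data.Product.Base using (Σ; _×_; _,_; proj₁; proj₂)
open import Data.Sum.Base using (_⊎_; inj₁; inj₂; [_,_]′)
import Data.Sum.Base as Sum
open import Data.Sum.Properties using (inj₁-injective)
open import Data.Vec.Base using (Vec)
import Data.Vec.Base as Vec
open import Data.Vec.Properties using (lookup∘tabulate)
open import Function.Base using (_∘_; _$_; id)
open import Function.Bundles using (_⇔_; mk⇔; Equivalence)
open import Function.Definitions using (Injective)
open import Relation.Binary.Definitions using (tri<; tri≈; tri>)
open import Relation.Binary.PropositionalEquality hiding (sym)
import Relation.Binary.PropositionalEquality as ≡
open import Relation.Nullary.Decidable using (⌊_⌋; yes; no; toWitness; fromWitness)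
open import Relation.Nullary.Decidable.Core using (T?)
open import Relation.Nullary.Negation using (¬_; contradiction)
open import Data.List.Membership.DecPropositional (Data.List.Properties.≡-dec Data.Nat.Properties._≟_) using (_∈?_)

indicator : Bool → ℕ
indicator b = if b then 1 else 0

count : ∀ {n} → (Fin n → Bool) → ℕ
count P = sum (tabulate (indicator ∘ P))

degree≡count : ∀ {n} (G : Graph n) v → degree G v ≡ count (adj G v)
degree≡count G v = cong sum (map-tabulate id (indicator ∘ adj G v))

_⊆ᵇ_ : ∀ {n} → (Fin n → Bool) → (Fin n → Bool) → Set
P ⊆ᵇ Q = ∀ u → P u ≡ true → Q u ≡ true

indicator-mono : ∀ {a b} → (a ≡ true → b ≡ true) → indicator a ≤ indicator b
indicator-mono {false} _ = z≤n
indicator-mono {true} a⇒b rewrite a⇒b refl = ≤-refl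

count-mono : ∀ {n} {P Q : Fin n → Bool} → P ⊆ᵇ Q → count P ≤ count Q
count-mono {zero} _ = z≤n
count-mono {suc n} P⊆Q = +-mono-≤ (indicator-mono (P⊆Q zero)) (count-mono (P⊆Q ∘ suc))

count-strict-mono : ∀ {n} {P Q : Fin n → Bool} {y} →
  P ⊆ᵇ Q → P y ≡ false → Q y ≡ true → count P < count Q
count-strict-mono {suc n} {P} {Q} {zero} P⊆Q Py Qy rewrite Py | Qy = s≤s (count-mono (P⊆Q ∘ suc))
count-strict-mono {suc n} {y = suc y} P⊆Q Py Qy =
  +-mono-≤-< (indicator-mono (P⊆Q zero)) (count-strict-mono (P⊆Q ∘ suc) Py Qy)

count-cong : ∀ {n} {P Q : Fin n → Bool} → (∀ u → P u ≡ Q u) → count P ≡ count Q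
count-cong {zero} _ = refl
count-cong {suc n} P≗Q = cong₂ _+_ (cong indicator (P≗Q zero)) (count-cong (P≗Q ∘ suc))

count-false : ∀ {n} (P : Fin n → Bool) → (∀ u → P u ≡ false) → count P ≡ 0
count-false {zero} P _ = refl
count-false {suc n} P P≗false rewrite P≗false zero = count-false (P ∘ suc) (P≗false ∘ suc)

_==_ : ∀ {n} → Fin n → Fin n → Bool
x == y = toℕ x ≡ᵇ toℕ y

==⇒≡ : ∀ {n} {x y : Fin n} → T (x == y) → x ≡ y
==⇒≡ x==y = toℕ-injective (≡ᵇ⇒≡ _ _ x==y)

≡⇒== : ∀ {n} {x y : Fin n} → x ≡ y → T (x == y)
≡⇒== {x = x} refl = ≡⇒≡ᵇ (toℕ x) (toℕ x) refl

==-sym : ∀ {n} (x y : Fin n) → (x == y) ≡ (y == x)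
==-sym zero    zero    = refl
==-sym zero    (suc y) = refl
==-sym (suc x) zero    = refl
==-sym (suc x) (suc y) = ==-sym x y

distinct : ∀ {n} → Fin n → Fin n → Bool
distinct x y = not (x == y)

T-not⇒¬T : ∀ {b} → T (not b) → ¬ T b
T-not⇒¬T {true} ()

not-==⇒≢ : ∀ {n} {x y : Fin n} → T (not (x == y)) → x ≢ y
not-==⇒≢ x≠y x≡y = T-not⇒¬T x≠y (≡⇒== x≡y)

≢⇒not-== : ∀ {n} {x y : Fin n} → x ≢ y → T (not (x == y))
≢⇒not-== {x = x} {y} x≢y with x == y in eq
... | true  = x≢y (==⇒≡ (Equivalence.from T-≡ eq))
... | false = _

count-true : ∀ {n} → count {n} (λ _ → true) ≡ n
count-true {zero} = refl
count-true {suc n} = cong suc count-true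

count-remove : ∀ {n} (P : Fin n → Bool) y →
  count P ≡ indicator (P y) + count (λ u → P u ∧ not (u == y))
count-remove {suc n} P zero = cong₂ _+_ refl (begin
  count (P ∘ suc)                              ≡⟨ count-cong (λ u → ≡.sym (∧-identityʳ (P (suc u)))) ⟩
  count (λ u → P (suc u) ∧ true)
    ≡⟨ cong (λ b → indicator b + count (λ u → P (suc u) ∧ true)) (≡.sym (∧-zeroʳ (P zero))) ⟩
  indicator (P zero ∧ false) + count (λ u → P (suc u) ∧ true) ∎)
  where open ≡-Reasoning
count-remove {suc n} P (suc y) = begin
  indicator (P zero) + count (P ∘ suc)
    ≡⟨ cong (indicator (P zero) +_) (count-remove (P ∘ suc) y) ⟩
  indicator (P zero) + (indicator (P (suc y)) + count rest)
    ≡⟨ x∙yz≈y∙xz (indicator (P zero)) (indicator (P (suc y))) (count rest) ⟩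
  indicator (P (suc y)) + (indicator (P zero) + count rest)
    ≡⟨ cong (λ b → indicator (P (suc y)) + (indicator b + count rest)) (≡.sym (∧-identityʳ (P zero))) ⟩
  indicator (P (suc y)) + (indicator (P zero ∧ true) + count rest) ∎
  where
  open ≡-Reasoning
  rest : Fin n → Bool
  rest u = P (suc u) ∧ not (u == y)

count-mono-injective : ∀ {k n} {P : Fin k → Bool} {Q : Fin n → Bool} (g : Fin k → Fin n) →
  Injective _≡_ _≡_ g → (∀ b → P b ≡ true → Q (g b) ≡ true) → count P ≤ count Q
count-mono-injective {zero} g _ _ = z≤n
count-mono-injective {suc k} {P = P} {Q} g g-injective P⇒Qg = begin
  indicator (P zero) + count (P ∘ suc)
    ≤⟨ +-mono-≤ (indicator-mono (P⇒Qg zero))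
                (count-mono-injective (g ∘ suc) (Fin.suc-injective ∘ g-injective) P⇒Q′g) ⟩
  indicator (Q (g zero)) + count (λ u → Q u ∧ not (u == g zero))
    ≡⟨ ≡.sym (count-remove Q (g zero)) ⟩
  count Q ∎
  where
  open ≤-Reasoning
  P⇒Q′g : ∀ b → P (suc b) ≡ true → (Q (g (suc b)) ∧ not (g (suc b) == g zero)) ≡ true
  P⇒Q′g b Pb with g (suc b) == g zero in gb==g0
  ... | true  = contradiction (g-injective (==⇒≡ (Equivalence.from T-≡ gb==g0))) λ ()
  ... | false = trans (∧-identityʳ _) (P⇒Qg (suc b) Pb)

-- Inserting a graphic block into a degree sequence

Graphic : List ℕ → Set
Graphic π = Σ (Graph (length π)) (HasDegreeSequence π)

module _ {A : Set} where

  outer : (xs zs ys : List A) → Fin (length (xs ++ ys)) → Fin (length (xs ++ zs ++ ys))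
  outer []       []       ys i       = i
  outer []       (z ∷ zs) ys i       = suc (outer [] zs ys i)
  outer (x ∷ xs) zs       ys zero    = zero
  outer (x ∷ xs) zs       ys (suc i) = suc (outer xs zs ys i)

  inner : (xs zs ys : List A) → Fin (length zs) → Fin (length (xs ++ zs ++ ys))
  inner []       (z ∷ zs) ys zero    = zero
  inner []       (z ∷ zs) ys (suc j) = suc (inner [] zs ys j)
  inner (x ∷ xs) zs       ys j       = suc (inner xs zs ys j)

  locate : (xs zs ys : List A) → Fin (length (xs ++ zs ++ ys)) → Fin (length (xs ++ ys)) ⊎ Fin (length zs)
  locate []       []       ys v       = inj₁ v
  locate []       (z ∷ zs) ys zero    = inj₂ zero
  locate []       (z ∷ zs) ys (suc v) = Sum.map id suc (locate [] zs ys v)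
  locate (x ∷ xs) zs       ys zero    = inj₁ zero
  locate (x ∷ xs) zs       ys (suc v) = Sum.map suc id (locate xs zs ys v)

  locate-outer : ∀ xs zs ys i → locate xs zs ys (outer xs zs ys i) ≡ inj₁ i
  locate-outer []       []       ys i       = refl
  locate-outer []       (z ∷ zs) ys i       rewrite locate-outer [] zs ys i = refl
  locate-outer (x ∷ xs) zs       ys zero    = refl
  locate-outer (x ∷ xs) zs       ys (suc i) rewrite locate-outer xs zs ys i = refl

  locate-inner : ∀ xs zs ys j → locate xs zs ys (inner xs zs ys j) ≡ inj₂ j
  locate-inner []       (z ∷ zs) ys zero    = refl
  locate-inner []       (z ∷ zs) ys (suc j) rewrite locate-inner [] zs ys j = refl
  locate-inner (x ∷ xs) zs       ys j       rewrite locate-inner xs zs ys j = refl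

  unlocate : ∀ xs zs ys v → [ outer xs zs ys , inner xs zs ys ]′ (locate xs zs ys v) ≡ v
  unlocate []       []       ys v       = refl
  unlocate []       (z ∷ zs) ys zero    = refl
  unlocate []       (z ∷ zs) ys (suc v) with locate [] zs ys v | unlocate [] zs ys v
  ... | inj₁ i | eq = cong suc eq
  ... | inj₂ j | eq = cong suc eq
  unlocate (x ∷ xs) zs       ys zero    = refl
  unlocate (x ∷ xs) zs       ys (suc v) with locate xs zs ys v | unlocate xs zs ys v
  ... | inj₁ i | eq = cong suc eq
  ... | inj₂ j | eq = cong suc eq

  lookup-outer : ∀ xs zs ys i → lookup (xs ++ zs ++ ys) (outer xs zs ys i) ≡ lookup (xs ++ ys) i
  lookup-outer []       []       ys i       = refl
  lookup-outer []       (z ∷ zs) ys i       = lookup-outer [] zs ys i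
  lookup-outer (x ∷ xs) zs       ys zero    = refl
  lookup-outer (x ∷ xs) zs       ys (suc i) = lookup-outer xs zs ys i

  lookup-inner : ∀ xs zs ys j → lookup (xs ++ zs ++ ys) (inner xs zs ys j) ≡ lookup zs j
  lookup-inner []       (z ∷ zs) ys zero    = refl
  lookup-inner []       (z ∷ zs) ys (suc j) = lookup-inner [] zs ys j
  lookup-inner (x ∷ xs) zs       ys j       = lookup-inner xs zs ys j

  count-splice : ∀ xs zs ys (P : Fin (length (xs ++ zs ++ ys)) → Bool) →
    count P ≡ count (P ∘ outer xs zs ys) + count (P ∘ inner xs zs ys)
  count-splice []       []       ys P = ≡.sym (+-identityʳ (count P))
  count-splice []       (z ∷ zs) ys P =
    trans (cong (indicator (P zero) +_) (count-splice [] zs ys (P ∘ suc)))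
          (x∙yz≈y∙xz (indicator (P zero)) (count (P ∘ suc ∘ outer [] zs ys))
                                           (count (P ∘ suc ∘ inner [] zs ys)))
  count-splice (x ∷ xs) zs       ys P =
    trans (cong (indicator (P zero) +_) (count-splice xs zs ys (P ∘ suc)))
          (≡.sym (+-assoc (indicator (P zero)) _ _))

sumAdj : ∀ {m n} → Graph m → Graph n → Fin m ⊎ Fin n → Fin m ⊎ Fin n → Bool
sumAdj G H (inj₁ a) (inj₁ b) = adj G a b
sumAdj G H (inj₂ a) (inj₂ b) = adj H a b
sumAdj G H _        _        = false

sumAdj-sym : ∀ {m n} (G : Graph m) (H : Graph n) p q → sumAdj G H p q ≡ sumAdj G H q p
sumAdj-sym G H (inj₁ a) (inj₁ b) = Graph.sym G a b
sumAdj-sym G H (inj₁ a) (inj₂ b) = refl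
sumAdj-sym G H (inj₂ a) (inj₁ b) = refl
sumAdj-sym G H (inj₂ a) (inj₂ b) = Graph.sym H a b

sumAdj-irrefl : ∀ {m n} (G : Graph m) (H : Graph n) p → sumAdj G H p p ≡ false
sumAdj-irrefl G H (inj₁ a) = irrefl G a
sumAdj-irrefl G H (inj₂ a) = irrefl H a

module _ (xs zs ys : List ℕ) (G : Graph (length (xs ++ ys))) (H : Graph (length zs)) where

  splice : Graph (length (xs ++ zs ++ ys))
  splice = record
    { adj    = λ u v → sumAdj G H (locate xs zs ys u) (locate xs zs ys v)
    ; sym    = λ u v → sumAdj-sym G H (locate xs zs ys u) (locate xs zs ys v)
    ; irrefl = λ v → sumAdj-irrefl G H (locate xs zs ys v)
    }

  degree-splice : ∀ u → degree splice u ≡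
    count (sumAdj G H (locate xs zs ys u) ∘ inj₁) + count (sumAdj G H (locate xs zs ys u) ∘ inj₂)
  degree-splice u = begin
    degree splice u                                               ≡⟨ degree≡count splice u ⟩
    count (adj splice u)                                          ≡⟨ count-splice xs zs ys (adj splice u) ⟩
    count (adj splice u ∘ outer xs zs ys) + count (adj splice u ∘ inner xs zs ys)
      ≡⟨ cong₂ _+_
           (count-cong {P = adj splice u ∘ outer xs zs ys} λ a → cong (sumAdj G H (locate xs zs ys u)) (locate-outer xs zs ys a))
           (count-cong {P = adj splice u ∘ inner xs zs ys} λ b → cong (sumAdj G H (locate xs zs ys u)) (locate-inner xs zs ys b)) ⟩
    count (sumAdj G H (locate xs zs ys u) ∘ inj₁) + count (sumAdj G H (locate xs zs ys u) ∘ inj₂) ∎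
    where open ≡-Reasoning

  module _ (dG : HasDegreeSequence (xs ++ ys) G) (dH : HasDegreeSequence zs H) where

    degree-outer : ∀ i → degree splice (outer xs zs ys i) ≡ lookup (xs ++ zs ++ ys) (outer xs zs ys i)
    degree-outer i = begin
      degree splice (outer xs zs ys i)                     ≡⟨ degree-splice _ ⟩
      count (sumAdj G H (locate xs zs ys (outer xs zs ys i)) ∘ inj₁) +
      count (sumAdj G H (locate xs zs ys (outer xs zs ys i)) ∘ inj₂)
        ≡⟨ cong (λ p → count (sumAdj G H p ∘ inj₁) + count (sumAdj G H p ∘ inj₂)) (locate-outer xs zs ys i) ⟩
      count (adj G i) + count (sumAdj G H (inj₁ i) ∘ inj₂)
        ≡⟨ cong (count (adj G i) +_) (count-false (sumAdj G H (inj₁ i) ∘ inj₂) λ _ → refl) ⟩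
      count (adj G i) + 0                                  ≡⟨ +-identityʳ _ ⟩
      count (adj G i)                                      ≡⟨ ≡.sym (degree≡count G i) ⟩
      degree G i                                           ≡⟨ dG i ⟩
      lookup (xs ++ ys) i                                  ≡⟨ ≡.sym (lookup-outer xs zs ys i) ⟩
      lookup (xs ++ zs ++ ys) (outer xs zs ys i)           ∎
      where open ≡-Reasoning

    degree-inner : ∀ j → degree splice (inner xs zs ys j) ≡ lookup (xs ++ zs ++ ys) (inner xs zs ys j)
    degree-inner j = begin
      degree splice (inner xs zs ys j)                     ≡⟨ degree-splice _ ⟩
      count (sumAdj G H (locate xs zs ys (inner xs zs ys j)) ∘ inj₁) +
      count (sumAdj G H (locate xs zs ys (inner xs zs ys j)) ∘ inj₂)
        ≡⟨ cong (λ p → count (sumAdj G H p ∘ inj₁) + count (sumAdj G H p ∘ inj₂)) (locate-inner xs zs ys j) ⟩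
      count (sumAdj G H (inj₂ j) ∘ inj₁) + count (adj H j)
        ≡⟨ cong (_+ count (adj H j)) (count-false (sumAdj G H (inj₂ j) ∘ inj₁) λ _ → refl) ⟩
      count (adj H j)                                      ≡⟨ ≡.sym (degree≡count H j) ⟩
      degree H j                                           ≡⟨ dH j ⟩
      lookup zs j                                          ≡⟨ ≡.sym (lookup-inner xs zs ys j) ⟩
      lookup (xs ++ zs ++ ys) (inner xs zs ys j)           ∎
      where open ≡-Reasoning

    splice-hasDegreeSequence : HasDegreeSequence (xs ++ zs ++ ys) splice
    splice-hasDegreeSequence v =
      subst (λ u → degree splice u ≡ lookup (xs ++ zs ++ ys) u) (unlocate xs zs ys v) (by-part (locate xs zs ys v))
      where
      by-part : ∀ p → let u = [ outer xs zs ys , inner xs zs ys ]′ p in degree splice u ≡ lookup (xs ++ zs ++ ys) u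
      by-part (inj₁ i) = degree-outer i
      by-part (inj₂ j) = degree-inner j

  splice-contains : ContainsK6-C5 G → ContainsK6-C5 splice
  splice-contains (f , f-injective , f-edges) = outer xs zs ys ∘ f , injective , edges
    where
    injective : Injective _≡_ _≡_ (outer xs zs ys ∘ f)
    injective {a} {b} eq = f-injective (inj₁-injective (begin
      inj₁ (f a)                              ≡⟨ ≡.sym (locate-outer xs zs ys (f a)) ⟩
      locate xs zs ys (outer xs zs ys (f a))  ≡⟨ cong (locate xs zs ys) eq ⟩
      locate xs zs ys (outer xs zs ys (f b))  ≡⟨ locate-outer xs zs ys (f b) ⟩
      inj₁ (f b)                              ∎))
      where open ≡-Reasoning
    edges : ∀ a b → K6-C5-edge a b → adj splice (outer xs zs ys (f a)) (outer xs zs ys (f b)) ≡ true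
    edges a b ab rewrite locate-outer xs zs ys (f a) | locate-outer xs zs ys (f b) = f-edges a b ab

splice-potentially : ∀ xs zs ys → PotentiallyK6-C5-Graphic (xs ++ ys) → Graphic zs →
  PotentiallyK6-C5-Graphic (xs ++ zs ++ ys)
splice-potentially xs zs ys (G , dG , G⊇H) (H , dH) =
  splice xs zs ys G H , splice-hasDegreeSequence xs zs ys G H dG dH , splice-contains xs zs ys G H G⊇H

-- Boolean checks are stated as `b ≡ true` and proved by `refl`; elaborating them at type `T b` instead
-- makes Agda evaluate b again wherever the type is compared.
≡true⇒T : ∀ {b} → b ≡ true → T b
≡true⇒T = Equivalence.from T-≡

all-true⁺ : ∀ {A : Set} (p : A → Bool) xs → all p xs ≡ true → All (T ∘ p) xs
all-true⁺ p xs holds = all⁺ p xs (≡true⇒T holds)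

all-allFin⁻ : ∀ {n} (p : Fin n → Bool) → T (all p (allFin n)) → ∀ x → T (p x)
all-allFin⁻ p holds x = All.lookup (all⁺ p (allFin _) holds) (∈-allFin x)

all²-allFin⁻ : ∀ {m n} (p : Fin m → Fin n → Bool) →
  T (all (λ a → all (p a) (allFin n)) (allFin m)) → ∀ a b → T (p a b)
all²-allFin⁻ p holds a b = all-allFin⁻ (p a) (all-allFin⁻ (λ a → all (p a) (allFin _)) holds a) b

k6-c5? : Fin 6 → Fin 6 → Bool
k6-c5? a b = not (a == b) ∧ not (c5edge (toℕ a) (toℕ b) ∨ c5edge (toℕ b) (toℕ a))

k6-c5?-sym : ∀ a b → k6-c5? a b ≡ k6-c5? b a
k6-c5?-sym a b = cong₂ _∧_ (cong not (==-sym a b)) (cong not (∨-comm (c5edge (toℕ a) (toℕ b)) _))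

k6-c5?-sound : ∀ a b → T (k6-c5? a b) → K6-C5-edge a b
k6-c5?-sound a b ab with Equivalence.to T-∧ ab
... | a≢b , not-c5 = not-==⇒≢ a≢b , Equivalence.to T-not-≡ not-c5

k6-c5?-complete : ∀ a b → K6-C5-edge a b → T (k6-c5? a b)
k6-c5?-complete a b (a≢b , not-c5) =
  Equivalence.from T-∧ (≢⇒not-== a≢b , Equivalence.from T-not-≡ not-c5)

testBit : ℕ → ℕ → Bool
testBit r zero    = r % 2 ≡ᵇ 1
testBit r (suc i) = testBit (r / 2) i

row : List ℕ → ℕ → ℕ
row []       _       = 0
row (r ∷ rs) zero    = r
row (r ∷ rs) (suc u) = row rs u

-- A graph is given by the list of its rows: bit v of row u says whether u and v are adjacent.
rowAdj : ∀ {n} → List ℕ → Fin n → Fin n → Bool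
rowAdj rows u v = testBit (row rows (toℕ u)) (toℕ v)

symmetricAt? : ∀ {n} → List ℕ → Fin n → Fin n → Bool
symmetricAt? rows u v = ⌊ rowAdj rows u v Bool.≟ rowAdj rows v u ⌋

simpleAt? : ∀ {n} → List ℕ → Fin n → Bool
simpleAt? {n} rows u = not (rowAdj rows u u) ∧ all (symmetricAt? rows u) (allFin n)

simple? : ℕ → List ℕ → Bool
simple? n rows = all (simpleAt? rows) (allFin n)

rowGraph : ∀ n rows → T (simple? n rows) → Graph n
rowGraph n rows ok = record
  { adj    = rowAdj rows
  ; sym    = λ u v → toWitness (all-allFin⁻ (symmetricAt? rows u) (proj₂ (at u)) v)
  ; irrefl = λ u → Equivalence.to T-not-≡ (proj₁ (at u))
  }
  where
  at : ∀ u → T (not (rowAdj rows u u)) × T (all (symmetricAt? rows u) (allFin n))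
  at u = Equivalence.to T-∧ (all-allFin⁻ (simpleAt? rows) ok u)

hasDegrees? : List ℕ → List ℕ → Bool
hasDegrees? π rows = all (λ v → count (rowAdj rows v) ≡ᵇ lookup π v) (allFin (length π))

graphic-rows : ∀ π rows → simple? (length π) rows ≡ true → hasDegrees? π rows ≡ true → Graphic π
graphic-rows π rows simple degrees =
  G , λ v → trans (degree≡count G v) (≡ᵇ⇒≡ _ _ (all-allFin⁻ _ (≡true⇒T degrees) v))
  where
  G : Graph (length π)
  G = rowGraph (length π) rows (≡true⇒T simple)

k6-c5⇒rowAdj? : List ℕ → Fin 6 → Fin 6 → Bool
k6-c5⇒rowAdj? rows a b = not (k6-c5? a b) ∨ rowAdj rows a b

startsWithK6-C5? : List ℕ → Bool
startsWithK6-C5? rows = all (λ a → all (k6-c5⇒rowAdj? rows a) (allFin 6)) (allFin 6)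

certifies? : List ℕ → List ℕ → Bool
certifies? π rows = simple? (length π) rows ∧ hasDegrees? π rows ∧ (6 ≤ᵇ length π) ∧ startsWithK6-C5? rows

certifies?-sound : ∀ π rows → T (certifies? π rows) → PotentiallyK6-C5-Graphic π
certifies?-sound π rows ok with Equivalence.to T-∧ ok
... | simple , rest with Equivalence.to T-∧ rest
... | degrees , rest′ with Equivalence.to T-∧ rest′
... | six≤n , starts = G , proj₂ graphic , f , injective , edges
  where
  graphic : Graphic π
  graphic = graphic-rows π rows (Equivalence.to T-≡ simple) (Equivalence.to T-≡ degrees)
  G : Graph (length π)
  G = proj₁ graphic
  6≤n : 6 ≤ length π
  6≤n = ≤ᵇ⇒≤ 6 (length π) six≤n
  f : Fin 6 → Fin (length π)
  f a = inject≤ a 6≤n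
  injective : ∀ {a b} → f a ≡ f b → a ≡ b
  injective = inject≤-injective 6≤n 6≤n _ _
  edges : ∀ a b → K6-C5-edge a b → adj G (f a) (f b) ≡ true
  edges a b ab with Equivalence.to T-∨ (all²-allFin⁻ (k6-c5⇒rowAdj? rows) starts a b)
  ... | inj₁ not-ab = contradiction (k6-c5?-complete a b ab) (T-not⇒¬T not-ab)
  ... | inj₂ adjacent rewrite toℕ-inject≤ a 6≤n | toℕ-inject≤ b 6≤n = Equivalence.to T-≡ adjacent

-- Regular blocks and the growth of (5, 4^i, 3^j, 2^k, 1^m)

graphic-[] : Graphic []
graphic-[] = record { adj = λ () ; sym = λ () ; irrefl = λ () } , λ ()

graphic-++ : ∀ {xs ys} → Graphic xs → Graphic ys → Graphic (xs ++ ys)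
graphic-++ {xs} {ys} (G , dG) (H , dH) = splice [] xs ys H G , splice-hasDegreeSequence [] xs ys H G dH dG

complete : ∀ n → Graph n
complete n = record
  { adj    = distinct
  ; sym    = λ u v → cong not (==-sym u v)
  ; irrefl = λ v → cong not (Equivalence.to T-≡ (≡⇒== {x = v} refl))
  }

count-others : ∀ {n} (u : Fin (suc n)) → count (distinct u) ≡ n
count-others {n} u = suc-injective (begin
  suc (count (distinct u))               ≡⟨ cong suc (count-cong λ v → cong not (==-sym u v)) ⟩
  suc (count (λ v → true ∧ not (v == u))) ≡⟨ ≡.sym (count-remove (λ _ → true) u) ⟩
  count {suc n} (λ _ → true)             ≡⟨ count-true ⟩
  suc n                                  ∎)
  where open ≡-Reasoning

lookup-replicate′ : ∀ n (x : ℕ) i → lookup (replicate n x) i ≡ x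
lookup-replicate′ (suc n) x zero    = refl
lookup-replicate′ (suc n) x (suc i) = lookup-replicate′ n x i

complete-graphic : ∀ r → Graphic (replicate (suc r) r)
complete-graphic r = complete _ , λ v → begin
  degree (complete _) v                ≡⟨ degree≡count (complete _) v ⟩
  count (distinct v)                   ≡⟨ count-others v ⟩
  length (replicate r r)               ≡⟨ length-replicate r ⟩
  r                                    ≡⟨ ≡.sym (lookup-replicate′ (suc r) r v) ⟩
  lookup (replicate (suc r) r) v       ∎
  where open ≡-Reasoning

-- The r-regular graphs on d vertices added as blocks of degree r; larger d are reached through K_{r+1}.
fourRegular : ∀ d → Maybe (Graphic (replicate d 4))
fourRegular 0 = just graphic-[]
fourRegular 5 = just (complete-graphic 4)
fourRegular 6 = just (graphic-rows _ (54 ∷ 45 ∷ 27 ∷ 54 ∷ 45 ∷ 27 ∷ []) refl refl)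
fourRegular 7 = just (graphic-rows _ (102 ∷ 77 ∷ 27 ∷ 54 ∷ 108 ∷ 89 ∷ 51 ∷ []) refl refl)
fourRegular 8 = just (graphic-rows _ (198 ∷ 141 ∷ 27 ∷ 54 ∷ 108 ∷ 216 ∷ 177 ∷ 99 ∷ []) refl refl)
fourRegular 9 = just (graphic-rows _ (390 ∷ 269 ∷ 27 ∷ 54 ∷ 108 ∷ 216 ∷ 432 ∷ 353 ∷ 195 ∷ []) refl refl)
fourRegular (suc (suc (suc (suc (suc d@(suc (suc (suc (suc (suc _)))))))))) =
  Maybe.map (graphic-++ (complete-graphic 4)) (fourRegular d)
fourRegular _ = nothing

threeRegular : ∀ d → Maybe (Graphic (replicate d 3))
threeRegular 0 = just graphic-[]
threeRegular 4 = just (complete-graphic 3)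
threeRegular 6 = just (graphic-rows _ (56 ∷ 56 ∷ 56 ∷ 7 ∷ 7 ∷ 7 ∷ []) refl refl)
threeRegular (suc (suc (suc (suc d@(suc (suc (suc (suc _)))))))) =
  Maybe.map (graphic-++ (complete-graphic 3)) (threeRegular d)
threeRegular _ = nothing

twoRegular : ∀ d → Maybe (Graphic (replicate d 2))
twoRegular 0 = just graphic-[]
twoRegular 3 = just (complete-graphic 2)
twoRegular 4 = just (graphic-rows _ (10 ∷ 5 ∷ 10 ∷ 5 ∷ []) refl refl)
twoRegular 5 = just (graphic-rows _ (18 ∷ 5 ∷ 10 ∷ 20 ∷ 9 ∷ []) refl refl)
twoRegular (suc (suc (suc d@(suc (suc (suc _)))))) = Maybe.map (graphic-++ (complete-graphic 2)) (twoRegular d)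
twoRegular _ = nothing

oneRegular : ∀ d → Maybe (Graphic (replicate d 1))
oneRegular 0               = just graphic-[]
oneRegular (suc (suc d))   = Maybe.map (graphic-++ (complete-graphic 1)) (oneRegular d)
oneRegular 1               = nothing

replicate-+ : ∀ m n (x : ℕ) → replicate (m + n) x ≡ replicate m x ++ replicate n x
replicate-+ zero    n x = refl
replicate-+ (suc m) n x = cong (x ∷_) (replicate-+ m n x)

grow : ∀ pre x a b post → PotentiallyK6-C5-Graphic (pre ++ replicate a x ++ post) → Graphic (replicate b x) →
  PotentiallyK6-C5-Graphic (pre ++ replicate (b + a) x ++ post)
grow pre x a b post P block =
  subst PotentiallyK6-C5-Graphic (cong (pre ++_) (begin
      replicate b x ++ replicate a x ++ post   ≡⟨ ++-assoc (replicate b x) _ post ⟨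
      (replicate b x ++ replicate a x) ++ post ≡⟨ cong (_++ post) (replicate-+ b a x) ⟨
      replicate (b + a) x ++ post              ∎))
    (splice-potentially pre (replicate b x) (replicate a x ++ post) P block)
  where open ≡-Reasoning

record Counts : Set where
  constructor ⟨_,_,_,_⟩
  field
    fours threes twos ones : ℕ

sequence : Counts → List ℕ
sequence ⟨ i , j , k , m ⟩ = 5 ∷ replicate i 4 ++ replicate j 3 ++ replicate k 2 ++ replicate m 1

record Potential (c : Counts) : Set where
  constructor potential
  field
    potentially : PotentiallyK6-C5-Graphic (sequence c)

add-fours : ∀ {d i j k m} → Graphic (replicate d 4) → Potential ⟨ i , j , k , m ⟩ → Potential ⟨ d + i , j , k , m ⟩
add-fours {d} {i} {j} {k} {m} block (potential P) =
  potential (grow (5 ∷ []) 4 i d (replicate j 3 ++ replicate k 2 ++ replicate m 1) P block)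

add-threes : ∀ {d i j k m} → Graphic (replicate d 3) → Potential ⟨ i , j , k , m ⟩ → Potential ⟨ i , d + j , k , m ⟩
add-threes {d} {i} {j} {k} {m} block (potential P) =
  potential (grow (5 ∷ replicate i 4) 3 j d (replicate k 2 ++ replicate m 1) P block)

add-twos : ∀ {d i j k m} → Graphic (replicate d 2) → Potential ⟨ i , j , k , m ⟩ → Potential ⟨ i , j , d + k , m ⟩
add-twos {d} {i} {j} {k} {m} block (potential P) = potential $
  subst PotentiallyK6-C5-Graphic (≡.sym (reassociate (d + k)))
    (grow (5 ∷ replicate i 4 ++ replicate j 3) 2 k d (replicate m 1)
      (subst PotentiallyK6-C5-Graphic (reassociate k) P) block)
  where
  reassociate : ∀ k′ →
    sequence ⟨ i , j , k′ , m ⟩ ≡ (5 ∷ replicate i 4 ++ replicate j 3) ++ replicate k′ 2 ++ replicate m 1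
  reassociate k′ = cong (5 ∷_) (≡.sym (++-assoc (replicate i 4) (replicate j 3) _))

add-ones : ∀ {d i j k m} → Graphic (replicate d 1) → Potential ⟨ i , j , k , m ⟩ → Potential ⟨ i , j , k , d + m ⟩
add-ones {d} {i} {j} {k} {m} block (potential P) = potential $
  subst PotentiallyK6-C5-Graphic (≡.sym (reassociate (d + m)))
    (grow (5 ∷ replicate i 4 ++ replicate j 3 ++ replicate k 2) 1 m d []
      (subst PotentiallyK6-C5-Graphic (reassociate m) P) block)
  where
  reassociate : ∀ m′ →
    sequence ⟨ i , j , k , m′ ⟩ ≡ (5 ∷ replicate i 4 ++ replicate j 3 ++ replicate k 2) ++ replicate m′ 1 ++ []
  reassociate m′ = cong (5 ∷_) (begin
    replicate i 4 ++ replicate j 3 ++ replicate k 2 ++ replicate m′ 1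
      ≡⟨ cong (λ ys → replicate i 4 ++ replicate j 3 ++ replicate k 2 ++ ys) (≡.sym (++-identityʳ _)) ⟩
    replicate i 4 ++ replicate j 3 ++ replicate k 2 ++ replicate m′ 1 ++ []
      ≡⟨ cong (replicate i 4 ++_) (≡.sym (++-assoc (replicate j 3) _ _)) ⟩
    replicate i 4 ++ (replicate j 3 ++ replicate k 2) ++ replicate m′ 1 ++ []
      ≡⟨ ≡.sym (++-assoc (replicate i 4) _ _) ⟩
    (replicate i 4 ++ replicate j 3 ++ replicate k 2) ++ replicate m′ 1 ++ [] ∎)
    where open ≡-Reasoning

growBlock : ∀ {r} (A : ℕ → Set) → (∀ d → Maybe (Graphic (replicate d r))) →
  (∀ {d x} → Graphic (replicate d r) → A x → A (d + x)) → ∀ a x → Maybe (A a → A x)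
growBlock A regular add a x with a ≤? x
... | no  _   = nothing
... | yes a≤x = Maybe.map (λ block → subst A (m∸n+n≡m a≤x) ∘ add block) (regular (x ∸ a))

extend : ∀ c b → Maybe (Potential b → Potential c)
extend ⟨ i , j , k , m ⟩ ⟨ a , b , c , e ⟩ = do
  grow₄ ← growBlock (λ x → Potential ⟨ x , b , c , e ⟩) fourRegular add-fours a i
  grow₃ ← growBlock (λ x → Potential ⟨ i , x , c , e ⟩) threeRegular add-threes b j
  grow₂ ← growBlock (λ x → Potential ⟨ i , j , x , e ⟩) twoRegular add-twos c k
  grow₁ ← growBlock (λ x → Potential ⟨ i , j , k , x ⟩) oneRegular add-ones e m
  just (grow₁ ∘ grow₂ ∘ grow₃ ∘ grow₄)

graphic-replicate-* : ∀ {p x} → Graphic (replicate p x) → ∀ q → Graphic (replicate (q * p) x)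
graphic-replicate-* block zero    = graphic-[]
graphic-replicate-* {p} {x} block (suc q) =
  subst Graphic (≡.sym (replicate-+ p (q * p) x))
    (graphic-++ {replicate p x} {replicate (q * p) x} block (graphic-replicate-* block q))

periodic : ∀ q₄ q₃ q₂ q₁ {i j k m} → Potential ⟨ i , j , k , m ⟩ →
  Potential ⟨ q₄ * 5 + i , q₃ * 4 + j , q₂ * 3 + k , q₁ * 2 + m ⟩
periodic q₄ q₃ q₂ q₁ =
    add-ones   (graphic-replicate-* (complete-graphic 1) q₁)
  ∘ add-twos   (graphic-replicate-* (complete-graphic 2) q₂)
  ∘ add-threes (graphic-replicate-* (complete-graphic 3) q₃)
  ∘ add-fours  (graphic-replicate-* (complete-graphic 4) q₄)

-- Bounding the edge set by the degrees

record Sandwich {n} (G : Graph n) (lower upper : Fin n → Fin n → Bool) : Set where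
  field
    lower-sym : ∀ x y → lower x y ≡ lower y x
    upper-sym : ∀ x y → upper x y ≡ upper y x
    lower⊆adj : ∀ x → lower x ⊆ᵇ adj G x
    adj⊆upper : ∀ x → adj G x ⊆ᵇ upper x

module _ {n} (d : Fin n → ℕ) where

  saturated : (Fin n → Fin n → Bool) → Fin n → Bool
  saturated lower x = d x ≤ᵇ count (lower x)

  tight : (Fin n → Fin n → Bool) → Fin n → Bool
  tight upper x = count (upper x) ≤ᵇ d x

  violated : (Fin n → Fin n → Bool) → (Fin n → Fin n → Bool) → Fin n → Bool
  violated lower upper x = (count (upper x) <ᵇ d x) ∨ (d x <ᵇ count (lower x))

prune : ∀ {n} → (Fin n → Bool) → (Fin n → Fin n → Bool) → (Fin n → Fin n → Bool) → Fin n → Fin n → Bool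
prune sat lower upper x y = upper x y ∧ (lower x y ∨ (not (sat x) ∧ not (sat y)))

force : ∀ {n} → (Fin n → Bool) → (Fin n → Fin n → Bool) → (Fin n → Fin n → Bool) → Fin n → Fin n → Bool
force tgt lower upper x y = lower x y ∨ (upper x y ∧ (tgt x ∨ tgt y))

module _ {n} {G : Graph n} {d : Fin n → ℕ} (degree-d : ∀ x → degree G x ≡ d x)
         {lower upper : Fin n → Fin n → Bool} (S : Sandwich G lower upper) where
  open Sandwich S

  count-adj : ∀ x → count (adj G x) ≡ d x
  count-adj x = trans (≡.sym (degree≡count G x)) (degree-d x)

  count-lower≤ : ∀ x → count (lower x) ≤ d x
  count-lower≤ x = subst (count (lower x) ≤_) (count-adj x) (count-mono (lower⊆adj x))

  ≤count-upper : ∀ x → d x ≤ count (upper x)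
  ≤count-upper x = subst (_≤ count (upper x)) (count-adj x) (count-mono (adj⊆upper x))

  saturated-edge : ∀ {x y} → d x ≤ count (lower x) → adj G x y ≡ true → lower x y ≡ true
  saturated-edge {x} {y} sat xy with lower x y in eq
  ... | true  = refl
  ... | false = contradiction
    (subst (count (lower x) <_) (count-adj x) (count-strict-mono (lower⊆adj x) eq xy)) (≤⇒≯ sat)

  tight-edge : ∀ {x y} → count (upper x) ≤ d x → upper x y ≡ true → adj G x y ≡ true
  tight-edge {x} {y} tgt xy with adj G x y in eq
  ... | true  = refl
  ... | false = contradiction
    (subst (_< count (upper x)) (count-adj x) (count-strict-mono (adj⊆upper x) eq xy)) (≤⇒≯ tgt)

  consistent : ∀ x → ¬ T (violated d lower upper x)
  consistent x v with Equivalence.to T-∨ v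
  ... | inj₁ upper< = ≤⇒≯ (≤count-upper x) (<ᵇ⇒< _ _ upper<)
  ... | inj₂ lower> = ≤⇒≯ (count-lower≤ x) (<ᵇ⇒< _ _ lower>)

  module _ {sat : Fin n → Bool} (sat-sound : ∀ x → T (sat x) → d x ≤ count (lower x)) where

    lower-or-unsaturated : ∀ x y → adj G x y ≡ true → (lower x y ∨ (not (sat x) ∧ not (sat y))) ≡ true
    lower-or-unsaturated x y xy with sat x in sx | sat y in sy
    ... | false | false = ∨-zeroʳ (lower x y)
    ... | true  | _     rewrite saturated-edge (sat-sound x (Equivalence.from T-≡ sx)) xy = refl
    ... | false | true  rewrite lower-sym x y
                              | saturated-edge (sat-sound y (Equivalence.from T-≡ sy)) (trans (Graph.sym G y x) xy) = refl

    prune-sandwich : Sandwich G lower (prune sat lower upper)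
    prune-sandwich = record
      { lower-sym = lower-sym
      ; upper-sym = λ x y → cong₂ _∧_ (upper-sym x y) (cong₂ _∨_ (lower-sym x y) (∧-comm (not (sat x)) (not (sat y))))
      ; lower⊆adj = lower⊆adj
      ; adj⊆upper = λ x y xy → cong₂ _∧_ (adj⊆upper x y xy) (lower-or-unsaturated x y xy)
      }

  module _ {tgt : Fin n → Bool} (tgt-sound : ∀ x → T (tgt x) → count (upper x) ≤ d x) where

    forced-edge : ∀ x y → (upper x y ∧ (tgt x ∨ tgt y)) ≡ true → adj G x y ≡ true
    forced-edge x y forced with upper x y in uxy | tgt x in tx | tgt y in ty
    ... | true | true | _    = tight-edge (tgt-sound x (Equivalence.from T-≡ tx)) uxy
    ... | true | false | true =
      trans (Graph.sym G x y) (tight-edge (tgt-sound y (Equivalence.from T-≡ ty)) (trans (upper-sym y x) uxy))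

    lower-or-forced : ∀ x y b → lower x y ≡ b → (b ∨ (upper x y ∧ (tgt x ∨ tgt y))) ≡ true → adj G x y ≡ true
    lower-or-forced x y true  lxy _      = lower⊆adj x y lxy
    lower-or-forced x y false _   forced = forced-edge x y forced

    force-sandwich : Sandwich G (force tgt lower upper) upper
    force-sandwich = record
      { lower-sym = λ x y → cong₂ _∨_ (lower-sym x y) (cong₂ _∧_ (upper-sym x y) (∨-comm (tgt x) (tgt y)))
      ; upper-sym = upper-sym
      ; lower⊆adj = λ x y → lower-or-forced x y (lower x y) refl
      ; adj⊆upper = adj⊆upper
      }

-- Symmetries of K₆ − C₅

record Automorphism (ρ : Fin 6 → Fin 6) : Set where
  field
    injective : Injective _≡_ _≡_ ρ
    preserves : ∀ a b → K6-C5-edge a b → K6-C5-edge (ρ a) (ρ b)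

automorphic? : (Fin 6 → Fin 6) → Fin 6 → Fin 6 → Bool
automorphic? ρ a b = (not (k6-c5? a b) ∨ k6-c5? (ρ a) (ρ b)) ∧ (not (ρ a == ρ b) ∨ (a == b))

isAutomorphism? : (Fin 6 → Fin 6) → Bool
isAutomorphism? ρ = all (λ a → all (automorphic? ρ a) (allFin 6)) (allFin 6)

isAutomorphism?-sound : ∀ ρ → T (isAutomorphism? ρ) → Automorphism ρ
isAutomorphism?-sound ρ ok = record
  { injective = λ {a} {b} → injective a b (proj₂ (at a b))
  ; preserves = λ a b → preserves a b (proj₁ (at a b))
  }
  where
  at : ∀ a b → T (not (k6-c5? a b) ∨ k6-c5? (ρ a) (ρ b)) × T (not (ρ a == ρ b) ∨ (a == b))
  at a b = Equivalence.to T-∧ (all²-allFin⁻ (automorphic? ρ) ok a b)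
  injective : ∀ a b → T (not (ρ a == ρ b) ∨ (a == b)) → ρ a ≡ ρ b → a ≡ b
  injective a b h ρa≡ρb with Equivalence.to T-∨ h
  ... | inj₁ ρa≢ρb = contradiction ρa≡ρb (not-==⇒≢ ρa≢ρb)
  ... | inj₂ a==b  = ==⇒≡ a==b
  preserves : ∀ a b → T (not (k6-c5? a b) ∨ k6-c5? (ρ a) (ρ b)) → K6-C5-edge a b → K6-C5-edge (ρ a) (ρ b)
  preserves a b h ab with Equivalence.to T-∨ h
  ... | inj₁ not-ab = contradiction (k6-c5?-complete a b ab) (T-not⇒¬T not-ab)
  ... | inj₂ ρab    = k6-c5?-sound (ρ a) (ρ b) ρab

-- The five rim vertices 1…5 of K₆ − C₅ form the removed 5-cycle; cycle position c is vertex suc c.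
next : Fin 5 → Fin 5
next zero                               = suc zero
next (suc zero)                         = suc (suc zero)
next (suc (suc zero))                   = suc (suc (suc zero))
next (suc (suc (suc zero)))             = suc (suc (suc (suc zero)))
next (suc (suc (suc (suc zero))))       = zero

reflect : Fin 5 → Fin 5
reflect zero                         = zero
reflect (suc zero)                   = suc (suc (suc (suc zero)))
reflect (suc (suc zero))             = suc (suc (suc zero))
reflect (suc (suc (suc zero)))       = suc (suc zero)
reflect (suc (suc (suc (suc zero)))) = suc zero

advance : ℕ → Fin 5 → Fin 5
advance zero    m = m
advance (suc k) m = next (advance k m)

orient : Bool → Fin 5 → Fin 5
orient s     zero = zero
orient false c    = c
orient true  c    = reflect c

-- The symmetry of K₆ − C₅ fixing the hub that sends cycle position 0 to m, reflecting the cycle if s.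
dihedral : Fin 5 → Bool → Fin 6 → Fin 6
dihedral m s zero    = zero
dihedral m s (suc c) = suc (advance (toℕ (orient s c)) m)

dihedral-automorphism : ∀ m s → Automorphism (dihedral m s)
dihedral-automorphism m s = isAutomorphism?-sound (dihedral m s) (by-orientation s)
  where
  both-orientations? : Fin 5 → Bool
  both-orientations? m = isAutomorphism? (dihedral m false) ∧ isAutomorphism? (dihedral m true)
  both : T (both-orientations? m)
  both = all-allFin⁻ both-orientations? _ m
  by-orientation : ∀ s → T (isAutomorphism? (dihedral m s))
  by-orientation false = proj₁ (Equivalence.to (T-∧ {isAutomorphism? (dihedral m false)}) both)
  by-orientation true  = proj₂ (Equivalence.to (T-∧ {isAutomorphism? (dihedral m false)}) both)

-- Every embedding takes this form after a symmetry (canonical-form), so only these are enumerated.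
record Canonical {n} (f : Fin 6 → Fin n) : Set where
  field
    rim-least : ∀ b → b ≢ zero → b ≢ suc zero → toℕ (f (suc zero)) < toℕ (f b)
    oriented  : toℕ (f (suc (suc zero))) < toℕ (f (suc (suc (suc (suc (suc zero))))))

module _ {n} (f : Fin 6 → Fin n) (f-injective : Injective _≡_ _≡_ f) where

  private
    key : Fin 5 → ℕ
    key c = toℕ (f (suc c))

  module _ (m : Fin 5) (minimal : ∀ c → key m ≤ key c) where

    private
      rim-least : ∀ s b → b ≢ zero → b ≢ suc zero → key m < toℕ (f (dihedral m s b))
      rim-least s b b≢0 b≢1 with dihedral m s b in ρb
      ... | zero  = contradiction (Automorphism.injective (dihedral-automorphism m s) ρb) b≢0
      ... | suc c = ≤∧≢⇒< (minimal c) λ keys≡ →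
        b≢1 (Automorphism.injective (dihedral-automorphism m s)
              (trans ρb (≡.sym (f-injective (toℕ-injective keys≡)))))

    canonical-from-least : Σ Bool λ s → Canonical (f ∘ dihedral m s)
    canonical-from-least with <-cmp (toℕ (f (dihedral m false (suc (suc zero)))))
                                    (toℕ (f (dihedral m false (suc (suc (suc (suc (suc zero))))))))
    ... | tri< two<five _ _ = false , record { rim-least = rim-least false ; oriented = two<five }
    ... | tri≈ _ two≡five _ = contradiction
      (Automorphism.injective (dihedral-automorphism m false) {suc (suc zero)} {suc (suc (suc (suc (suc zero))))}
        (f-injective (toℕ-injective two≡five))) λ ()
    ... | tri> _ _ five<two = true  , record { rim-least = rim-least true ; oriented = five<two }

  -- Opaque because unfolding argmin on open terms makes type checking blow up.
  opaque
    canonical-form : Σ (Fin 5 × Bool) λ (m , s) → Canonical (f ∘ dihedral m s)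
    canonical-form = (m , proj₁ canonical) , proj₂ canonical
      where
      m : Fin 5
      m = argmin key zero (allFin 5)
      canonical : Σ Bool λ s → Canonical (f ∘ dihedral m s)
      canonical = canonical-from-least m λ c → All.lookup (f[argmin]≤f[xs] {f = key} zero (allFin 5)) (∈-allFin c)

-- Refuting every embedding of K₆ − C₅

preimage : ∀ {k n} → (Fin k → Fin n) → Fin n → Maybe (Fin k)
preimage {zero}  f x = nothing
preimage {suc k} f x = if f zero == x then just zero else Maybe.map suc (preimage (f ∘ suc) x)

preimage-sound : ∀ {k n} (f : Fin k → Fin n) x {a} → preimage f x ≡ just a → f a ≡ x
preimage-sound {suc k} f x eq with f zero == x in f0==x
preimage-sound {suc k} f x refl | true  = ==⇒≡ (Equivalence.from T-≡ f0==x)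
... | false with preimage (f ∘ suc) x in found
preimage-sound {suc k} f x refl | false | just a = preimage-sound (f ∘ suc) x found

imageEdges : ∀ {n} → (Fin n → Maybe (Fin 6)) → Fin n → Fin n → Bool
imageEdges pre x y with pre x | pre y
... | just a | just b = k6-c5? a b
... | _      | _      = false

module _ {n} {G : Graph n} {f : Fin 6 → Fin n} (f-edges : ∀ a b → K6-C5-edge a b → adj G (f a) (f b) ≡ true)
         {pre : Fin n → Maybe (Fin 6)} (pre-sound : ∀ x {a} → pre x ≡ just a → f a ≡ x) where

  imageEdges-sym : ∀ x y → imageEdges pre x y ≡ imageEdges pre y x
  imageEdges-sym x y with pre x | pre y
  ... | just a  | just b  = k6-c5?-sym a b
  ... | just _  | nothing = refl
  ... | nothing | just _  = refl
  ... | nothing | nothing = refl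

  imageEdges⊆adj : ∀ x → imageEdges pre x ⊆ᵇ adj G x
  imageEdges⊆adj x y xy with pre x in px | pre y in py
  ... | just a | just b = subst₂ (λ u v → adj G u v ≡ true) (pre-sound x px) (pre-sound y py)
                            (f-edges a b (k6-c5?-sound a b (Equivalence.from T-≡ xy)))

  adj⊆distinct : ∀ x → adj G x ⊆ᵇ distinct x
  adj⊆distinct x y xy with x == y in x==y
  ... | false = refl
  ... | true  with ==⇒≡ {x = x} {y} (Equivalence.from T-≡ x==y)
  ...   | refl = contradiction (trans (≡.sym xy) (irrefl G x)) λ ()

  image-sandwich : Sandwich G (imageEdges pre) distinct
  image-sandwich = record
    { lower-sym = imageEdges-sym
    ; upper-sym = λ x y → cong not (==-sym x y)
    ; lower⊆adj = imageEdges⊆adj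
    ; adj⊆upper = adj⊆distinct
    }

module _ {n} (d : Fin n → ℕ) where

  -- Each stage receives the per-vertex data of the previous one as a vector, so it is evaluated only once.
  refutes-tight : (Fin n → Fin n → Bool) → (Fin n → Fin n → Bool) → Vec Bool n → Bool
  refutes-tight lower upper tgt = any (violated d (force (Vec.lookup tgt) lower upper) upper) (allFin n)

  refutes-saturated : (Fin n → Fin n → Bool) → Vec Bool n → Bool
  refutes-saturated lower sat =
    refutes-tight lower (prune (Vec.lookup sat) lower distinct)
                        (Vec.tabulate (tight d (prune (Vec.lookup sat) lower distinct)))

  refutes-preimage : Vec (Maybe (Fin 6)) n → Bool
  refutes-preimage pre =
    refutes-saturated (imageEdges (Vec.lookup pre)) (Vec.tabulate (saturated d (imageEdges (Vec.lookup pre))))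

  refutes : (Fin 6 → Fin n) → Bool
  refutes f = refutes-preimage (Vec.tabulate (preimage f))

module _ {n} {G : Graph n} {d : Fin n → ℕ} (degree-d : ∀ x → degree G x ≡ d x) where

  refutes-sound : ∀ f → (∀ a b → K6-C5-edge a b → adj G (f a) (f b) ≡ true) → ¬ T (refutes d f)
  refutes-sound f f-edges refuted = consistent degree-d S₂ x violated-x
    where
    pre : Fin n → Maybe (Fin 6)
    pre = Vec.lookup (Vec.tabulate (preimage f))
    lower₀ : Fin n → Fin n → Bool
    lower₀ = imageEdges pre
    S₀ : Sandwich G lower₀ distinct
    S₀ = image-sandwich f-edges λ x eq → preimage-sound f x (trans (≡.sym (lookup∘tabulate (preimage f) x)) eq)
    sat : Fin n → Bool
    sat = Vec.lookup (Vec.tabulate (saturated d lower₀))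
    upper₁ : Fin n → Fin n → Bool
    upper₁ = prune sat lower₀ distinct
    S₁ : Sandwich G lower₀ upper₁
    S₁ = prune-sandwich degree-d S₀ λ x h → ≤ᵇ⇒≤ _ _ (subst T (lookup∘tabulate (saturated d lower₀) x) h)
    tgt : Fin n → Bool
    tgt = Vec.lookup (Vec.tabulate (tight d upper₁))
    S₂ : Sandwich G (force tgt lower₀ upper₁) upper₁
    S₂ = force-sandwich degree-d S₁ λ x h → ≤ᵇ⇒≤ _ _ (subst T (lookup∘tabulate (tight d upper₁) x) h)
    x : Fin n
    x = proj₁ (satisfied (any⁻ _ (allFin n) refuted))
    violated-x : T (violated d (force tgt lower₀ upper₁) upper₁ x)
    violated-x = proj₂ (satisfied (any⁻ _ (allFin n) refuted))

module _ {n} (d : Fin n → ℕ) where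

  candidate? : List (Fin n) → List (Fin n) → Fin n → Bool
  candidate? others smaller v = (3 ≤ᵇ d v) ∧ all (distinct v) others ∧ all (λ w → toℕ w <ᵇ toℕ v) smaller

  candidates : List (Fin n) → List (Fin n) → List (Fin n)
  candidates others smaller = filterᵇ (candidate? others smaller) (allFin n)

  -- Enumerates the canonical embeddings v₀ … v₅, pruned by degree, injectivity and `Canonical`.
  search₅ : (v₀ v₁ v₂ v₃ v₄ : Fin n) → Bool
  search₅ v₀ v₁ v₂ v₃ v₄ =
    all (λ v₅ → refutes d (Vec.lookup (v₀ Vec.∷ v₁ Vec.∷ v₂ Vec.∷ v₃ Vec.∷ v₄ Vec.∷ v₅ Vec.∷ Vec.[])))
        (candidates (v₀ ∷ v₃ ∷ v₄ ∷ []) (v₁ ∷ v₂ ∷ []))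

  search₄ : (v₀ v₁ v₂ v₃ : Fin n) → Bool
  search₄ v₀ v₁ v₂ v₃ = all (search₅ v₀ v₁ v₂ v₃) (candidates (v₀ ∷ v₂ ∷ v₃ ∷ []) (v₁ ∷ []))

  search₃ : (v₀ v₁ v₂ : Fin n) → Bool
  search₃ v₀ v₁ v₂ = all (search₄ v₀ v₁ v₂) (candidates (v₀ ∷ v₂ ∷ []) (v₁ ∷ []))

  search₂ : (v₀ v₁ : Fin n) → Bool
  search₂ v₀ v₁ = all (search₃ v₀ v₁) (candidates (v₀ ∷ []) (v₁ ∷ []))

  search₁ : Fin n → Bool
  search₁ v₀ = all (search₂ v₀) (candidates (v₀ ∷ []) [])

  noEmbedding? : Bool
  noEmbedding? = all search₁ (filterᵇ (λ v → 5 ≤ᵇ d v) (allFin n))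

  all-filterᵇ : ∀ {p q : Fin n → Bool} → T (all q (filterᵇ p (allFin n))) → ∀ v → T (p v) → T (q v)
  all-filterᵇ {p} {q} holds v pv = All.lookup (all⁺ q _ holds) (∈-filter⁺ (T? ∘ p) (∈-allFin v) pv)

  candidate?-complete : ∀ {others smaller v} → 3 ≤ d v → All (v ≢_) others → All (λ w → toℕ w < toℕ v) smaller →
    T (candidate? others smaller v)
  candidate?-complete {others} {smaller} {v} 3≤dv others≢v smaller<v =
    Equivalence.from T-∧ (≤⇒≤ᵇ 3≤dv , Equivalence.from T-∧
      (all⁻ (distinct v) (All.map ≢⇒not-== others≢v) , all⁻ (λ w → toℕ w <ᵇ toℕ v) (All.map <⇒<ᵇ smaller<v)))

module _ {n} {G : Graph n} {d : Fin n → ℕ} (degree-d : ∀ x → degree G x ≡ d x)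
         (f : Fin 6 → Fin n) (f-injective : Injective _≡_ _≡_ f)
         (f-edges : ∀ a b → K6-C5-edge a b → adj G (f a) (f b) ≡ true) where

  k6-c5-degree≤ : ∀ a → count (k6-c5? a) ≤ d (f a)
  k6-c5-degree≤ a = subst (count (k6-c5? a) ≤_) (trans (≡.sym (degree≡count G (f a))) (degree-d (f a)))
    (count-mono-injective {P = k6-c5? a} {Q = adj G (f a)} f f-injective
      λ b ab → f-edges a b (k6-c5?-sound a b (Equivalence.from T-≡ ab)))

  image-distinct : ∀ {a b} → a ≢ b → f a ≢ f b
  image-distinct a≢b = a≢b ∘ f-injective

  noEmbedding?-sound : T (noEmbedding? d) → ¬ Canonical f
  noEmbedding?-sound none canonical = refutes-sound {G = G} degree-d F F-edges s₆
    where
    open Canonical canonical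
    f₀ f₁ f₂ f₃ f₄ f₅ : Fin n
    f₀ = f zero
    f₁ = f (suc zero)
    f₂ = f (suc (suc zero))
    f₃ = f (suc (suc (suc zero)))
    f₄ = f (suc (suc (suc (suc zero))))
    f₅ = f (suc (suc (suc (suc (suc zero)))))
    F : Fin 6 → Fin n
    F = Vec.lookup (f₀ Vec.∷ f₁ Vec.∷ f₂ Vec.∷ f₃ Vec.∷ f₄ Vec.∷ f₅ Vec.∷ Vec.[])
    F-edges : ∀ a b → K6-C5-edge a b → adj G (F a) (F b) ≡ true
    F-edges a b ab =
      subst₂ (λ u v → adj G u v ≡ true) (≡.sym (lookup∘tabulate f a)) (≡.sym (lookup∘tabulate f b)) (f-edges a b ab)
    s₁ : T (search₁ d f₀)
    s₁ = all-filterᵇ d {p = λ v → 5 ≤ᵇ d v} {q = search₁ d} none f₀ (≤⇒≤ᵇ (k6-c5-degree≤ zero))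
    s₂ : T (search₂ d f₀ f₁)
    s₂ = all-filterᵇ d {p = candidate? d (f₀ ∷ []) []} {q = search₂ d f₀} s₁ f₁
           (candidate?-complete d (k6-c5-degree≤ (suc zero)) (image-distinct (λ ()) ∷ []) [])
    s₃ : T (search₃ d f₀ f₁ f₂)
    s₃ = all-filterᵇ d {p = candidate? d (f₀ ∷ []) (f₁ ∷ [])} {q = search₃ d f₀ f₁} s₂ f₂
           (candidate?-complete d (k6-c5-degree≤ (suc (suc zero))) (image-distinct (λ ()) ∷ [])
             (rim-least _ (λ ()) (λ ()) ∷ []))
    s₄ : T (search₄ d f₀ f₁ f₂ f₃)
    s₄ = all-filterᵇ d {p = candidate? d (f₀ ∷ f₂ ∷ []) (f₁ ∷ [])} {q = search₄ d f₀ f₁ f₂} s₃ f₃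
           (candidate?-complete d (k6-c5-degree≤ (suc (suc (suc zero))))
             (image-distinct (λ ()) ∷ image-distinct (λ ()) ∷ []) (rim-least _ (λ ()) (λ ()) ∷ []))
    s₅ : T (search₅ d f₀ f₁ f₂ f₃ f₄)
    s₅ = all-filterᵇ d {p = candidate? d (f₀ ∷ f₂ ∷ f₃ ∷ []) (f₁ ∷ [])} {q = search₅ d f₀ f₁ f₂ f₃} s₄ f₄
           (candidate?-complete d (k6-c5-degree≤ (suc (suc (suc (suc zero)))))
             (image-distinct (λ ()) ∷ image-distinct (λ ()) ∷ image-distinct (λ ()) ∷ []) (rim-least _ (λ ()) (λ ()) ∷ []))
    s₆ : T (refutes d F)
    s₆ = all-filterᵇ d {p = candidate? d (f₀ ∷ f₃ ∷ f₄ ∷ []) (f₁ ∷ f₂ ∷ [])}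
           {q = λ v₅ → refutes d (Vec.lookup (f₀ Vec.∷ f₁ Vec.∷ f₂ Vec.∷ f₃ Vec.∷ f₄ Vec.∷ v₅ Vec.∷ Vec.[]))} s₅ f₅
           (candidate?-complete d (k6-c5-degree≤ (suc (suc (suc (suc (suc zero))))))
             (image-distinct (λ ()) ∷ image-distinct (λ ()) ∷ image-distinct (λ ()) ∷ []) (rim-least _ (λ ()) (λ ()) ∷ oriented ∷ []))

-- Base realizations and the reduction to a finite box

-- Realizations, with K₆ − C₅ on the first six vertices, of the sequences from which all others are grown.
baseCertificates : List (Counts × List ℕ)
baseCertificates =
    (⟨ 0 , 5 , 0 , 0 ⟩ , (62 ∷ 25 ∷ 49 ∷ 35 ∷ 7 ∷ 13 ∷ []))
  ∷ (⟨ 0 , 5 , 1 , 2 ⟩ , (62 ∷ 25 ∷ 49 ∷ 35 ∷ 7 ∷ 13 ∷ 384 ∷ 64 ∷ 64 ∷ []))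
  ∷ (⟨ 0 , 5 , 2 , 2 ⟩ , (62 ∷ 25 ∷ 49 ∷ 35 ∷ 7 ∷ 13 ∷ 384 ∷ 576 ∷ 64 ∷ 128 ∷ []))
  ∷ (⟨ 0 , 6 , 0 , 3 ⟩ , (62 ∷ 25 ∷ 49 ∷ 35 ∷ 7 ∷ 13 ∷ 896 ∷ 64 ∷ 64 ∷ 64 ∷ []))
  ∷ (⟨ 0 , 6 , 1 , 3 ⟩ , (62 ∷ 25 ∷ 49 ∷ 35 ∷ 7 ∷ 13 ∷ 896 ∷ 1088 ∷ 64 ∷ 64 ∷ 128 ∷ []))
  ∷ (⟨ 0 , 6 , 2 , 1 ⟩ , (62 ∷ 25 ∷ 49 ∷ 35 ∷ 7 ∷ 13 ∷ 896 ∷ 320 ∷ 192 ∷ 64 ∷ []))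
  ∷ (⟨ 0 , 6 , 3 , 1 ⟩ , (62 ∷ 25 ∷ 49 ∷ 35 ∷ 7 ∷ 13 ∷ 896 ∷ 320 ∷ 192 ∷ 1088 ∷ 512 ∷ []))
  ∷ (⟨ 0 , 6 , 4 , 1 ⟩ , (62 ∷ 25 ∷ 49 ∷ 35 ∷ 7 ∷ 13 ∷ 896 ∷ 320 ∷ 192 ∷ 1088 ∷ 2560 ∷ 1024 ∷ []))
  ∷ (⟨ 0 , 7 , 0 , 4 ⟩ , (62 ∷ 25 ∷ 49 ∷ 35 ∷ 7 ∷ 13 ∷ 896 ∷ 3136 ∷ 64 ∷ 64 ∷ 128 ∷ 128 ∷ []))
  ∷ (⟨ 0 , 7 , 1 , 2 ⟩ , (62 ∷ 25 ∷ 49 ∷ 35 ∷ 7 ∷ 13 ∷ 896 ∷ 1344 ∷ 192 ∷ 64 ∷ 128 ∷ []))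
  ∷ (⟨ 0 , 7 , 2 , 0 ⟩ , (62 ∷ 25 ∷ 49 ∷ 35 ∷ 7 ∷ 13 ∷ 896 ∷ 832 ∷ 192 ∷ 192 ∷ []))
  ∷ (⟨ 0 , 7 , 3 , 0 ⟩ , (62 ∷ 25 ∷ 49 ∷ 35 ∷ 7 ∷ 13 ∷ 896 ∷ 1344 ∷ 192 ∷ 1088 ∷ 640 ∷ []))
  ∷ (⟨ 0 , 7 , 4 , 0 ⟩ , (62 ∷ 25 ∷ 49 ∷ 35 ∷ 7 ∷ 13 ∷ 896 ∷ 1344 ∷ 192 ∷ 2112 ∷ 2176 ∷ 1536 ∷ []))
  ∷ (⟨ 0 , 8 , 0 , 3 ⟩ , (62 ∷ 25 ∷ 49 ∷ 35 ∷ 7 ∷ 13 ∷ 896 ∷ 1344 ∷ 2240 ∷ 64 ∷ 128 ∷ 256 ∷ []))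
  ∷ (⟨ 0 , 8 , 1 , 1 ⟩ , (62 ∷ 25 ∷ 49 ∷ 35 ∷ 7 ∷ 13 ∷ 896 ∷ 832 ∷ 1216 ∷ 192 ∷ 256 ∷ []))
  ∷ (⟨ 0 , 8 , 2 , 1 ⟩ , (62 ∷ 25 ∷ 49 ∷ 35 ∷ 7 ∷ 13 ∷ 896 ∷ 832 ∷ 1216 ∷ 192 ∷ 2304 ∷ 1024 ∷ []))
  ∷ (⟨ 0 , 8 , 3 , 1 ⟩ , (62 ∷ 25 ∷ 49 ∷ 35 ∷ 7 ∷ 13 ∷ 896 ∷ 832 ∷ 1216 ∷ 192 ∷ 2304 ∷ 5120 ∷ 2048 ∷ []))
  ∷ (⟨ 0 , 9 , 1 , 0 ⟩ , (62 ∷ 25 ∷ 49 ∷ 35 ∷ 7 ∷ 13 ∷ 896 ∷ 832 ∷ 1216 ∷ 1216 ∷ 768 ∷ []))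
  ∷ (⟨ 0 , 9 , 2 , 0 ⟩ , (62 ∷ 25 ∷ 49 ∷ 35 ∷ 7 ∷ 13 ∷ 896 ∷ 832 ∷ 1216 ∷ 2240 ∷ 2304 ∷ 1536 ∷ []))
  ∷ (⟨ 0 , 10 , 0 , 1 ⟩ , (62 ∷ 25 ∷ 49 ∷ 35 ∷ 7 ∷ 13 ∷ 896 ∷ 832 ∷ 1216 ∷ 1216 ∷ 2816 ∷ 1024 ∷ []))
  ∷ (⟨ 0 , 10 , 1 , 1 ⟩ , (62 ∷ 25 ∷ 49 ∷ 35 ∷ 7 ∷ 13 ∷ 896 ∷ 832 ∷ 1216 ∷ 1216 ∷ 2816 ∷ 5120 ∷ 2048 ∷ []))
  ∷ (⟨ 0 , 11 , 1 , 0 ⟩ , (62 ∷ 25 ∷ 49 ∷ 35 ∷ 7 ∷ 13 ∷ 896 ∷ 832 ∷ 1216 ∷ 2240 ∷ 6400 ∷ 5632 ∷ 3072 ∷ []))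
  ∷ (⟨ 0 , 12 , 0 , 1 ⟩ , (62 ∷ 25 ∷ 49 ∷ 35 ∷ 7 ∷ 13 ∷ 896 ∷ 832 ∷ 1216 ∷ 2240 ∷ 6400 ∷ 5632 ∷ 11264 ∷ 4096 ∷ []))
  ∷ (⟨ 1 , 4 , 0 , 1 ⟩ , (62 ∷ 89 ∷ 49 ∷ 35 ∷ 7 ∷ 13 ∷ 2 ∷ []))
  ∷ (⟨ 1 , 4 , 1 , 1 ⟩ , (62 ∷ 89 ∷ 49 ∷ 35 ∷ 7 ∷ 13 ∷ 130 ∷ 64 ∷ []))
  ∷ (⟨ 1 , 4 , 2 , 1 ⟩ , (62 ∷ 89 ∷ 49 ∷ 35 ∷ 7 ∷ 13 ∷ 130 ∷ 320 ∷ 128 ∷ []))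
  ∷ (⟨ 1 , 5 , 0 , 2 ⟩ , (62 ∷ 89 ∷ 49 ∷ 35 ∷ 7 ∷ 13 ∷ 386 ∷ 64 ∷ 64 ∷ []))
  ∷ (⟨ 1 , 5 , 1 , 2 ⟩ , (62 ∷ 89 ∷ 49 ∷ 35 ∷ 7 ∷ 13 ∷ 386 ∷ 576 ∷ 64 ∷ 128 ∷ []))
  ∷ (⟨ 1 , 5 , 2 , 0 ⟩ , (62 ∷ 89 ∷ 49 ∷ 35 ∷ 7 ∷ 13 ∷ 386 ∷ 320 ∷ 192 ∷ []))
  ∷ (⟨ 1 , 5 , 3 , 0 ⟩ , (62 ∷ 537 ∷ 49 ∷ 35 ∷ 7 ∷ 13 ∷ 896 ∷ 320 ∷ 192 ∷ 66 ∷ []))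
  ∷ (⟨ 1 , 5 , 4 , 0 ⟩ , (62 ∷ 1049 ∷ 49 ∷ 35 ∷ 7 ∷ 13 ∷ 896 ∷ 320 ∷ 192 ∷ 1088 ∷ 514 ∷ []))
  ∷ (⟨ 1 , 6 , 0 , 3 ⟩ , (62 ∷ 89 ∷ 49 ∷ 35 ∷ 7 ∷ 13 ∷ 386 ∷ 1600 ∷ 64 ∷ 128 ∷ 128 ∷ []))
  ∷ (⟨ 1 , 6 , 1 , 1 ⟩ , (62 ∷ 89 ∷ 49 ∷ 35 ∷ 7 ∷ 13 ∷ 386 ∷ 832 ∷ 192 ∷ 128 ∷ []))
  ∷ (⟨ 1 , 6 , 2 , 1 ⟩ , (62 ∷ 1049 ∷ 49 ∷ 35 ∷ 7 ∷ 13 ∷ 896 ∷ 832 ∷ 192 ∷ 192 ∷ 2 ∷ []))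
  ∷ (⟨ 1 , 6 , 3 , 1 ⟩ , (62 ∷ 1049 ∷ 49 ∷ 35 ∷ 7 ∷ 13 ∷ 896 ∷ 832 ∷ 192 ∷ 192 ∷ 2050 ∷ 1024 ∷ []))
  ∷ (⟨ 1 , 7 , 0 , 2 ⟩ , (62 ∷ 89 ∷ 49 ∷ 35 ∷ 7 ∷ 13 ∷ 386 ∷ 832 ∷ 1216 ∷ 128 ∷ 256 ∷ []))
  ∷ (⟨ 1 , 7 , 1 , 0 ⟩ , (62 ∷ 281 ∷ 49 ∷ 35 ∷ 7 ∷ 13 ∷ 896 ∷ 832 ∷ 194 ∷ 192 ∷ []))
  ∷ (⟨ 1 , 7 , 2 , 0 ⟩ , (62 ∷ 1049 ∷ 49 ∷ 35 ∷ 7 ∷ 13 ∷ 896 ∷ 832 ∷ 1216 ∷ 192 ∷ 258 ∷ []))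
  ∷ (⟨ 1 , 7 , 3 , 0 ⟩ , (62 ∷ 2073 ∷ 49 ∷ 35 ∷ 7 ∷ 13 ∷ 896 ∷ 832 ∷ 1216 ∷ 192 ∷ 2304 ∷ 1026 ∷ []))
  ∷ (⟨ 1 , 9 , 0 , 0 ⟩ , (62 ∷ 1049 ∷ 49 ∷ 35 ∷ 7 ∷ 13 ∷ 896 ∷ 832 ∷ 1216 ∷ 1216 ∷ 770 ∷ []))
  ∷ (⟨ 1 , 9 , 1 , 0 ⟩ , (62 ∷ 2073 ∷ 49 ∷ 35 ∷ 7 ∷ 13 ∷ 896 ∷ 832 ∷ 1216 ∷ 1216 ∷ 2816 ∷ 1026 ∷ []))
  ∷ (⟨ 1 , 11 , 0 , 0 ⟩ , (62 ∷ 4121 ∷ 49 ∷ 35 ∷ 7 ∷ 13 ∷ 896 ∷ 832 ∷ 1216 ∷ 2240 ∷ 6400 ∷ 5632 ∷ 3074 ∷ []))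
  ∷ (⟨ 2 , 3 , 0 , 0 ⟩ , (62 ∷ 29 ∷ 51 ∷ 35 ∷ 7 ∷ 13 ∷ []))
  ∷ (⟨ 2 , 3 , 1 , 0 ⟩ , (62 ∷ 89 ∷ 113 ∷ 35 ∷ 7 ∷ 13 ∷ 6 ∷ []))
  ∷ (⟨ 2 , 3 , 2 , 0 ⟩ , (62 ∷ 89 ∷ 177 ∷ 35 ∷ 7 ∷ 13 ∷ 130 ∷ 68 ∷ []))
  ∷ (⟨ 2 , 4 , 0 , 1 ⟩ , (62 ∷ 89 ∷ 113 ∷ 35 ∷ 7 ∷ 13 ∷ 134 ∷ 64 ∷ []))
  ∷ (⟨ 2 , 4 , 1 , 1 ⟩ , (62 ∷ 89 ∷ 113 ∷ 35 ∷ 7 ∷ 13 ∷ 134 ∷ 320 ∷ 128 ∷ []))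
  ∷ (⟨ 2 , 4 , 2 , 1 ⟩ , (62 ∷ 89 ∷ 561 ∷ 35 ∷ 7 ∷ 13 ∷ 386 ∷ 320 ∷ 192 ∷ 4 ∷ []))
  ∷ (⟨ 2 , 5 , 0 , 2 ⟩ , (62 ∷ 89 ∷ 113 ∷ 35 ∷ 7 ∷ 13 ∷ 134 ∷ 832 ∷ 128 ∷ 128 ∷ []))
  ∷ (⟨ 2 , 5 , 1 , 0 ⟩ , (62 ∷ 89 ∷ 177 ∷ 35 ∷ 7 ∷ 13 ∷ 386 ∷ 324 ∷ 192 ∷ []))
  ∷ (⟨ 2 , 5 , 2 , 0 ⟩ , (62 ∷ 29 ∷ 51 ∷ 35 ∷ 7 ∷ 13 ∷ 896 ∷ 832 ∷ 192 ∷ 192 ∷ []))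
  ∷ (⟨ 2 , 5 , 3 , 0 ⟩ , (62 ∷ 1049 ∷ 1073 ∷ 35 ∷ 7 ∷ 13 ∷ 896 ∷ 832 ∷ 192 ∷ 192 ∷ 6 ∷ []))
  ∷ (⟨ 2 , 6 , 0 , 1 ⟩ , (62 ∷ 89 ∷ 177 ∷ 35 ∷ 7 ∷ 13 ∷ 386 ∷ 324 ∷ 704 ∷ 256 ∷ []))
  ∷ (⟨ 2 , 6 , 1 , 1 ⟩ , (62 ∷ 281 ∷ 1073 ∷ 35 ∷ 7 ∷ 13 ∷ 896 ∷ 832 ∷ 194 ∷ 192 ∷ 4 ∷ []))
  ∷ (⟨ 2 , 6 , 2 , 1 ⟩ , (62 ∷ 1049 ∷ 2097 ∷ 35 ∷ 7 ∷ 13 ∷ 896 ∷ 832 ∷ 1216 ∷ 192 ∷ 258 ∷ 4 ∷ []))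
  ∷ (⟨ 3 , 2 , 0 , 1 ⟩ , (62 ∷ 29 ∷ 51 ∷ 99 ∷ 7 ∷ 13 ∷ 8 ∷ []))
  ∷ (⟨ 3 , 2 , 1 , 1 ⟩ , (62 ∷ 89 ∷ 113 ∷ 163 ∷ 7 ∷ 13 ∷ 6 ∷ 8 ∷ []))
  ∷ (⟨ 3 , 2 , 2 , 1 ⟩ , (62 ∷ 89 ∷ 177 ∷ 291 ∷ 7 ∷ 13 ∷ 130 ∷ 68 ∷ 8 ∷ []))
  ∷ (⟨ 3 , 3 , 0 , 0 ⟩ , (62 ∷ 89 ∷ 113 ∷ 99 ∷ 7 ∷ 13 ∷ 14 ∷ []))
  ∷ (⟨ 3 , 3 , 1 , 0 ⟩ , (62 ∷ 89 ∷ 113 ∷ 163 ∷ 7 ∷ 13 ∷ 134 ∷ 72 ∷ []))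
  ∷ (⟨ 3 , 3 , 2 , 0 ⟩ , (62 ∷ 89 ∷ 57 ∷ 39 ∷ 7 ∷ 13 ∷ 386 ∷ 320 ∷ 192 ∷ []))
  ∷ (⟨ 3 , 4 , 0 , 1 ⟩ , (62 ∷ 89 ∷ 113 ∷ 163 ∷ 7 ∷ 13 ∷ 134 ∷ 328 ∷ 128 ∷ []))
  ∷ (⟨ 3 , 4 , 1 , 1 ⟩ , (62 ∷ 89 ∷ 177 ∷ 547 ∷ 7 ∷ 13 ∷ 386 ∷ 324 ∷ 192 ∷ 8 ∷ []))
  ∷ (⟨ 3 , 4 , 2 , 1 ⟩ , (62 ∷ 29 ∷ 51 ∷ 1059 ∷ 7 ∷ 13 ∷ 896 ∷ 832 ∷ 192 ∷ 192 ∷ 8 ∷ []))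
  ∷ (⟨ 3 , 5 , 0 , 0 ⟩ , (62 ∷ 89 ∷ 177 ∷ 291 ∷ 7 ∷ 13 ∷ 386 ∷ 324 ∷ 200 ∷ []))
  ∷ (⟨ 3 , 5 , 1 , 0 ⟩ , (62 ∷ 281 ∷ 57 ∷ 39 ∷ 7 ∷ 13 ∷ 896 ∷ 832 ∷ 194 ∷ 192 ∷ []))
  ∷ (⟨ 3 , 5 , 2 , 0 ⟩ , (62 ∷ 1049 ∷ 57 ∷ 39 ∷ 7 ∷ 13 ∷ 896 ∷ 832 ∷ 1216 ∷ 192 ∷ 258 ∷ []))
  ∷ (⟨ 4 , 1 , 0 , 0 ⟩ , (62 ∷ 29 ∷ 51 ∷ 51 ∷ 15 ∷ 13 ∷ []))
  ∷ (⟨ 4 , 1 , 1 , 0 ⟩ , (62 ∷ 89 ∷ 113 ∷ 51 ∷ 15 ∷ 13 ∷ 6 ∷ []))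
  ∷ (⟨ 4 , 1 , 2 , 0 ⟩ , (62 ∷ 89 ∷ 177 ∷ 51 ∷ 15 ∷ 13 ∷ 130 ∷ 68 ∷ []))
  ∷ (⟨ 4 , 2 , 0 , 1 ⟩ , (62 ∷ 89 ∷ 113 ∷ 99 ∷ 135 ∷ 13 ∷ 14 ∷ 16 ∷ []))
  ∷ (⟨ 4 , 2 , 1 , 1 ⟩ , (62 ∷ 89 ∷ 113 ∷ 163 ∷ 263 ∷ 13 ∷ 134 ∷ 72 ∷ 16 ∷ []))
  ∷ (⟨ 4 , 2 , 2 , 1 ⟩ , (62 ∷ 89 ∷ 57 ∷ 39 ∷ 519 ∷ 13 ∷ 386 ∷ 320 ∷ 192 ∷ 16 ∷ []))
  ∷ (⟨ 4 , 3 , 0 , 0 ⟩ , (62 ∷ 89 ∷ 113 ∷ 163 ∷ 135 ∷ 13 ∷ 134 ∷ 88 ∷ []))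
  ∷ (⟨ 4 , 3 , 1 , 0 ⟩ , (62 ∷ 89 ∷ 177 ∷ 51 ∷ 15 ∷ 13 ∷ 386 ∷ 324 ∷ 192 ∷ []))
  ∷ (⟨ 4 , 3 , 2 , 0 ⟩ , (62 ∷ 29 ∷ 51 ∷ 51 ∷ 15 ∷ 13 ∷ 896 ∷ 832 ∷ 192 ∷ 192 ∷ []))
  ∷ (⟨ 4 , 4 , 0 , 1 ⟩ , (62 ∷ 89 ∷ 177 ∷ 291 ∷ 519 ∷ 13 ∷ 386 ∷ 324 ∷ 200 ∷ 16 ∷ []))
  ∷ (⟨ 4 , 4 , 1 , 1 ⟩ , (62 ∷ 281 ∷ 57 ∷ 39 ∷ 1031 ∷ 13 ∷ 896 ∷ 832 ∷ 194 ∷ 192 ∷ 16 ∷ []))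
  ∷ (⟨ 4 , 4 , 2 , 1 ⟩ , (62 ∷ 1049 ∷ 57 ∷ 39 ∷ 2055 ∷ 13 ∷ 896 ∷ 832 ∷ 1216 ∷ 192 ∷ 258 ∷ 16 ∷ []))
  ∷ (⟨ 5 , 0 , 0 , 1 ⟩ , (62 ∷ 29 ∷ 51 ∷ 51 ∷ 15 ∷ 77 ∷ 32 ∷ []))
  ∷ (⟨ 5 , 0 , 1 , 1 ⟩ , (62 ∷ 89 ∷ 113 ∷ 51 ∷ 15 ∷ 141 ∷ 6 ∷ 32 ∷ []))
  ∷ (⟨ 5 , 0 , 2 , 1 ⟩ , (62 ∷ 89 ∷ 177 ∷ 51 ∷ 15 ∷ 269 ∷ 130 ∷ 68 ∷ 32 ∷ []))
  ∷ (⟨ 5 , 1 , 0 , 0 ⟩ , (62 ∷ 89 ∷ 113 ∷ 99 ∷ 39 ∷ 29 ∷ 14 ∷ []))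
  ∷ (⟨ 5 , 1 , 1 , 0 ⟩ , (62 ∷ 89 ∷ 113 ∷ 163 ∷ 39 ∷ 29 ∷ 134 ∷ 72 ∷ []))
  ∷ (⟨ 5 , 1 , 2 , 0 ⟩ , (62 ∷ 89 ∷ 57 ∷ 39 ∷ 39 ∷ 29 ∷ 386 ∷ 320 ∷ 192 ∷ []))
  ∷ (⟨ 5 , 2 , 0 , 1 ⟩ , (62 ∷ 89 ∷ 113 ∷ 163 ∷ 135 ∷ 269 ∷ 134 ∷ 88 ∷ 32 ∷ []))
  ∷ (⟨ 5 , 2 , 1 , 1 ⟩ , (62 ∷ 89 ∷ 177 ∷ 51 ∷ 15 ∷ 525 ∷ 386 ∷ 324 ∷ 192 ∷ 32 ∷ []))
  ∷ (⟨ 5 , 2 , 2 , 1 ⟩ , (62 ∷ 29 ∷ 51 ∷ 51 ∷ 15 ∷ 1037 ∷ 896 ∷ 832 ∷ 192 ∷ 192 ∷ 32 ∷ []))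
  ∷ (⟨ 5 , 3 , 0 , 0 ⟩ , (62 ∷ 89 ∷ 177 ∷ 291 ∷ 39 ∷ 29 ∷ 386 ∷ 324 ∷ 200 ∷ []))
  ∷ (⟨ 5 , 3 , 1 , 0 ⟩ , (62 ∷ 281 ∷ 57 ∷ 39 ∷ 39 ∷ 29 ∷ 896 ∷ 832 ∷ 194 ∷ 192 ∷ []))
  ∷ (⟨ 5 , 3 , 2 , 0 ⟩ , (62 ∷ 1049 ∷ 57 ∷ 39 ∷ 39 ∷ 29 ∷ 896 ∷ 832 ∷ 1216 ∷ 192 ∷ 258 ∷ []))
  ∷ (⟨ 6 , 0 , 0 , 1 ⟩ , (62 ∷ 89 ∷ 113 ∷ 99 ∷ 71 ∷ 141 ∷ 30 ∷ 32 ∷ []))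
  ∷ (⟨ 6 , 0 , 1 , 1 ⟩ , (62 ∷ 89 ∷ 113 ∷ 99 ∷ 135 ∷ 269 ∷ 142 ∷ 80 ∷ 32 ∷ []))
  ∷ (⟨ 6 , 0 , 2 , 1 ⟩ , (62 ∷ 89 ∷ 113 ∷ 51 ∷ 15 ∷ 525 ∷ 390 ∷ 320 ∷ 192 ∷ 32 ∷ []))
  ∷ (⟨ 6 , 1 , 0 , 0 ⟩ , (62 ∷ 89 ∷ 113 ∷ 99 ∷ 135 ∷ 141 ∷ 142 ∷ 112 ∷ []))
  ∷ (⟨ 6 , 1 , 1 , 0 ⟩ , (62 ∷ 89 ∷ 113 ∷ 163 ∷ 39 ∷ 29 ∷ 390 ∷ 328 ∷ 192 ∷ []))
  ∷ (⟨ 6 , 1 , 2 , 0 ⟩ , (62 ∷ 89 ∷ 57 ∷ 39 ∷ 39 ∷ 29 ∷ 898 ∷ 832 ∷ 192 ∷ 192 ∷ []))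
  ∷ (⟨ 6 , 2 , 0 , 1 ⟩ , (62 ∷ 89 ∷ 113 ∷ 163 ∷ 263 ∷ 525 ∷ 390 ∷ 328 ∷ 208 ∷ 32 ∷ []))
  ∷ (⟨ 6 , 2 , 1 , 1 ⟩ , (62 ∷ 89 ∷ 305 ∷ 51 ∷ 15 ∷ 1037 ∷ 898 ∷ 832 ∷ 196 ∷ 192 ∷ 32 ∷ []))
  ∷ (⟨ 6 , 2 , 2 , 1 ⟩ , (62 ∷ 29 ∷ 51 ∷ 51 ∷ 15 ∷ 2061 ∷ 1920 ∷ 832 ∷ 1216 ∷ 192 ∷ 320 ∷ 32 ∷ []))
  ∷ (⟨ 6 , 3 , 0 , 0 ⟩ , (62 ∷ 89 ∷ 57 ∷ 39 ∷ 39 ∷ 29 ∷ 898 ∷ 832 ∷ 704 ∷ 448 ∷ []))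
  ∷ (⟨ 6 , 3 , 1 , 0 ⟩ , (62 ∷ 1049 ∷ 57 ∷ 39 ∷ 39 ∷ 29 ∷ 1920 ∷ 832 ∷ 704 ∷ 448 ∷ 66 ∷ []))
  ∷ (⟨ 6 , 3 , 2 , 0 ⟩ , (62 ∷ 2073 ∷ 57 ∷ 39 ∷ 39 ∷ 29 ∷ 1920 ∷ 832 ∷ 704 ∷ 448 ∷ 2112 ∷ 1026 ∷ []))
  ∷ (⟨ 7 , 0 , 0 , 1 ⟩ , (62 ∷ 89 ∷ 113 ∷ 99 ∷ 135 ∷ 141 ∷ 142 ∷ 368 ∷ 128 ∷ []))
  ∷ (⟨ 7 , 0 , 1 , 1 ⟩ , (62 ∷ 89 ∷ 113 ∷ 163 ∷ 135 ∷ 525 ∷ 390 ∷ 344 ∷ 192 ∷ 32 ∷ []))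
  ∷ (⟨ 7 , 0 , 2 , 1 ⟩ , (62 ∷ 89 ∷ 177 ∷ 51 ∷ 15 ∷ 1037 ∷ 898 ∷ 836 ∷ 192 ∷ 192 ∷ 32 ∷ []))
  ∷ (⟨ 7 , 1 , 0 , 0 ⟩ , (62 ∷ 89 ∷ 113 ∷ 163 ∷ 135 ∷ 269 ∷ 390 ∷ 344 ∷ 224 ∷ []))
  ∷ (⟨ 7 , 1 , 1 , 0 ⟩ , (62 ∷ 89 ∷ 177 ∷ 291 ∷ 39 ∷ 29 ∷ 898 ∷ 836 ∷ 200 ∷ 192 ∷ []))
  ∷ (⟨ 7 , 1 , 2 , 0 ⟩ , (62 ∷ 281 ∷ 57 ∷ 39 ∷ 39 ∷ 29 ∷ 1920 ∷ 1856 ∷ 194 ∷ 192 ∷ 192 ∷ []))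
  ∷ (⟨ 7 , 2 , 0 , 1 ⟩ , (62 ∷ 89 ∷ 177 ∷ 51 ∷ 15 ∷ 1037 ∷ 898 ∷ 836 ∷ 704 ∷ 448 ∷ 32 ∷ []))
  ∷ (⟨ 7 , 2 , 1 , 1 ⟩ , (62 ∷ 29 ∷ 51 ∷ 51 ∷ 15 ∷ 2061 ∷ 1920 ∷ 1856 ∷ 704 ∷ 448 ∷ 192 ∷ 32 ∷ []))
  ∷ (⟨ 7 , 2 , 2 , 1 ⟩ , (62 ∷ 2073 ∷ 2097 ∷ 51 ∷ 15 ∷ 4109 ∷ 1920 ∷ 1856 ∷ 704 ∷ 448 ∷ 192 ∷ 6 ∷ 32 ∷ []))
  ∷ (⟨ 8 , 0 , 0 , 1 ⟩ , (62 ∷ 89 ∷ 113 ∷ 163 ∷ 135 ∷ 269 ∷ 390 ∷ 344 ∷ 736 ∷ 256 ∷ []))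
  ∷ (⟨ 8 , 0 , 1 , 1 ⟩ , (62 ∷ 89 ∷ 177 ∷ 291 ∷ 263 ∷ 1037 ∷ 898 ∷ 836 ∷ 216 ∷ 192 ∷ 32 ∷ []))
  ∷ (⟨ 8 , 0 , 2 , 1 ⟩ , (62 ∷ 281 ∷ 305 ∷ 51 ∷ 15 ∷ 2061 ∷ 1920 ∷ 1856 ∷ 198 ∷ 192 ∷ 192 ∷ 32 ∷ []))
  ∷ (⟨ 8 , 1 , 0 , 0 ⟩ , (62 ∷ 89 ∷ 177 ∷ 291 ∷ 39 ∷ 29 ∷ 898 ∷ 836 ∷ 712 ∷ 448 ∷ []))
  ∷ (⟨ 8 , 1 , 1 , 0 ⟩ , (62 ∷ 281 ∷ 57 ∷ 39 ∷ 39 ∷ 29 ∷ 1920 ∷ 1856 ∷ 706 ∷ 448 ∷ 192 ∷ []))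
  ∷ (⟨ 8 , 1 , 2 , 0 ⟩ , (62 ∷ 2073 ∷ 57 ∷ 39 ∷ 39 ∷ 29 ∷ 1920 ∷ 1856 ∷ 2752 ∷ 448 ∷ 192 ∷ 258 ∷ []))
  ∷ (⟨ 9 , 0 , 0 , 1 ⟩ , (62 ∷ 89 ∷ 177 ∷ 291 ∷ 519 ∷ 1037 ∷ 898 ∷ 836 ∷ 712 ∷ 464 ∷ 32 ∷ []))
  ∷ (⟨ 9 , 0 , 1 , 1 ⟩ , (62 ∷ 281 ∷ 561 ∷ 51 ∷ 15 ∷ 2061 ∷ 1920 ∷ 1856 ∷ 706 ∷ 452 ∷ 192 ∷ 32 ∷ []))
  ∷ (⟨ 9 , 0 , 2 , 1 ⟩ , (62 ∷ 29 ∷ 51 ∷ 51 ∷ 15 ∷ 4109 ∷ 1920 ∷ 1856 ∷ 2752 ∷ 2496 ∷ 192 ∷ 768 ∷ 32 ∷ []))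
  ∷ []

base-certified : All (λ e → T (certifies? (sequence (proj₁ e)) (proj₂ e))) baseCertificates
base-certified = all-true⁺ (λ e → certifies? (sequence (proj₁ e)) (proj₂ e)) baseCertificates refl

realizable? : Counts → Bool
realizable? c = any (λ e → is-just (extend c (proj₁ e))) baseCertificates

realizable?-sound : ∀ c → T (realizable? c) → Potential c
realizable?-sound c found =
  to-witness-T (extend c base) extends (potential (certifies?-sound (sequence base) (proj₂ entry) certified))
  where
  witness : Any (λ e → T (is-just (extend c (proj₁ e)))) baseCertificates
  witness = any⁻ (λ e → is-just (extend c (proj₁ e))) baseCertificates found
  entry : Counts × List ℕ
  entry = Any.lookup witness
  base : Counts
  base = proj₁ entry
  certified : T (certifies? (sequence base) (proj₂ entry))
  certified = proj₁ (All.lookupAny base-certified witness)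
  extends : T (is-just (extend c base))
  extends = proj₂ (All.lookupAny base-certified witness)

sum-replicate : ∀ n x → sum (replicate n x) ≡ n * x
sum-replicate zero    x = refl
sum-replicate (suc n) x = cong (x +_) (sum-replicate n x)

sum-sequence : ∀ i j k m → sum (sequence ⟨ i , j , k , m ⟩) ≡ 5 + (i * 4 + (j * 3 + (k * 2 + m * 1)))
sum-sequence i j k m = cong (5 +_) (begin
  sum (replicate i 4 ++ replicate j 3 ++ replicate k 2 ++ replicate m 1)
    ≡⟨ sum-++ (replicate i 4) _ ⟩
  sum (replicate i 4) + sum (replicate j 3 ++ replicate k 2 ++ replicate m 1)
    ≡⟨ cong (sum (replicate i 4) +_) (sum-++ (replicate j 3) _) ⟩
  sum (replicate i 4) + (sum (replicate j 3) + sum (replicate k 2 ++ replicate m 1))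
    ≡⟨ cong (λ s → sum (replicate i 4) + (sum (replicate j 3) + s)) (sum-++ (replicate k 2) _) ⟩
  sum (replicate i 4) + (sum (replicate j 3) + (sum (replicate k 2) + sum (replicate m 1)))
    ≡⟨ cong₂ _+_ (sum-replicate i 4) (cong₂ _+_ (sum-replicate j 3) (cong₂ _+_ (sum-replicate k 2) (sum-replicate m 1))) ⟩
  i * 4 + (j * 3 + (k * 2 + m * 1)) ∎)
  where open ≡-Reasoning

sum-periodic : ∀ q₄ q₃ q₂ q₁ i j k m →
  sum (sequence ⟨ q₄ * 5 + i , q₃ * 4 + j , q₂ * 3 + k , q₁ * 2 + m ⟩) ≡
  2 * (q₄ * 10 + q₃ * 6 + q₂ * 3 + q₁) + sum (sequence ⟨ i , j , k , m ⟩)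
sum-periodic q₄ q₃ q₂ q₁ i j k m =
  trans (sum-sequence (q₄ * 5 + i) (q₃ * 4 + j) (q₂ * 3 + k) (q₁ * 2 + m))
    (trans (shift q₄ q₃ q₂ q₁ i j k m) (cong (2 * (q₄ * 10 + q₃ * 6 + q₂ * 3 + q₁) +_) (≡.sym (sum-sequence i j k m))))
  where
  shift : ∀ q₄ q₃ q₂ q₁ i j k m →
    5 + ((q₄ * 5 + i) * 4 + ((q₃ * 4 + j) * 3 + ((q₂ * 3 + k) * 2 + (q₁ * 2 + m) * 1))) ≡
    2 * (q₄ * 10 + q₃ * 6 + q₂ * 3 + q₁) + (5 + (i * 4 + (j * 3 + (k * 2 + m * 1))))
  shift = solve-∀

record Reduction (w p x : ℕ) : Set where
  field
    quotient residue : ℕ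
    x≡ : x ≡ quotient * p + residue
    residue< : residue < w + p
    unchanged-or-large : residue ≡ x ⊎ w ≤ residue

reduce : ∀ w p .{{_ : NonZero p}} x → Reduction w p x
reduce w p x with x <? w
... | yes x<w = record
  { quotient = 0 ; residue = x ; x≡ = refl
  ; residue< = ≤-trans x<w (m≤m+n w p) ; unchanged-or-large = inj₁ refl }
... | no x≮w = record
  { quotient = t / p ; residue = w + t % p
  ; x≡ = begin
      x                       ≡⟨ m∸n+n≡m (≮⇒≥ x≮w) ⟨
      t + w                   ≡⟨ cong (_+ w) (m≡m%n+[m/n]*n t p) ⟩
      (t % p + t / p * p) + w ≡⟨ rearrange (t % p) (t / p * p) w ⟩
      t / p * p + (w + t % p) ∎
  ; residue< = +-monoʳ-< w (m%n<n t p) ; unchanged-or-large = inj₂ (m≤m+n w (t % p)) }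
  where
  open ≡-Reasoning
  t = x ∸ w
  rearrange : ∀ a b c → (a + b) + c ≡ b + (c + a)
  rearrange = solve-∀

admissible? : Counts → Bool
admissible? c@(⟨ i , j , k , m ⟩) = ⌊ 2 ∣? sum (sequence c) ⌋ ∧ (5 ≤ᵇ i + j)

-- The window starts of the reductions in potential-unless-exceptional: an unreduced residue is unchanged.
unreduced? : Counts → Bool
unreduced? ⟨ i , j , k , m ⟩ = (i <ᵇ 5) ∧ (j <ᵇ 9) ∧ (k <ᵇ 3) ∧ (m <ᵇ 3)

settled? : Counts → Bool
settled? c = not (admissible? c) ∨ (⌊ sequence c ∈? exceptions ⌋ ∧ unreduced? c) ∨ realizable? c

allBelow : ℕ → (ℕ → Bool) → Bool
allBelow n p = all p (upTo n)

allBelow-sound : ∀ n p → T (allBelow n p) → ∀ {x} → x < n → T (p x)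
allBelow-sound n p holds x<n = All.lookup (all⁺ p (upTo n) holds) (∈-upTo⁺ x<n)

box : (Counts → Bool) → Bool
box p = allBelow 10 λ i → allBelow 13 λ j → allBelow 6 λ k → allBelow 5 λ m → p ⟨ i , j , k , m ⟩

box-sound : ∀ p → box p ≡ true → ∀ {i j k m} → i < 10 → j < 13 → k < 6 → m < 5 → T (p ⟨ i , j , k , m ⟩)
box-sound p holds {i} {j} {k} i<10 j<13 k<6 m<5 =
  allBelow-sound 5 (λ m → p ⟨ i , j , k , m ⟩)
    (allBelow-sound 6 (λ k → allBelow 5 λ m → p ⟨ i , j , k , m ⟩)
      (allBelow-sound 13 (λ j → allBelow 6 λ k → allBelow 5 λ m → p ⟨ i , j , k , m ⟩)
        (allBelow-sound 10 (λ i → allBelow 13 λ j → allBelow 6 λ k → allBelow 5 λ m → p ⟨ i , j , k , m ⟩)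
          (≡true⇒T holds) i<10) j<13) k<6) m<5

box-settled : box settled? ≡ true
box-settled = refl

residue-potential : ∀ r → T (settled? r) → T (admissible? r) → (T (unreduced? r) → sequence r ∉ exceptions) →
  Potential r
residue-potential r settled admissible unreduced⇒∉ = settled-cases (Equivalence.to (T-∨ {x = inadmissible?}) settled)
  where
  inadmissible? exceptional? : Bool
  inadmissible? = not (admissible? r)
  exceptional?  = ⌊ sequence r ∈? exceptions ⌋ ∧ unreduced? r
  exceptional-cases : T exceptional? ⊎ T (realizable? r) → Potential r
  exceptional-cases (inj₁ exceptional) = contradiction (toWitness (proj₁ parts)) (unreduced⇒∉ (proj₂ parts))
    where parts = Equivalence.to (T-∧ {⌊ sequence r ∈? exceptions ⌋}) exceptional
  exceptional-cases (inj₂ realizable) = realizable?-sound r realizable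
  settled-cases : T inadmissible? ⊎ T (exceptional? ∨ realizable? r) → Potential r
  settled-cases (inj₁ inadmissible) = contradiction admissible (T-not⇒¬T inadmissible)
  settled-cases (inj₂ rest)         = exceptional-cases (Equivalence.to (T-∨ {x = exceptional?}) rest)

residue-unchanged : ∀ {w p x} (R : Reduction w p x) → Reduction.residue R < w → Reduction.residue R ≡ x
residue-unchanged R small with Reduction.unchanged-or-large R
... | inj₁ unchanged = unchanged
... | inj₂ large     = contradiction small (≤⇒≯ large)

counts-cong : ∀ {i j k m i′ j′ k′ m′} → i ≡ i′ → j ≡ j′ → k ≡ k′ → m ≡ m′ → ⟨ i , j , k , m ⟩ ≡ ⟨ i′ , j′ , k′ , m′ ⟩
counts-cong refl refl refl refl = refl

unreduced?-sound : ∀ c → T (unreduced? c) →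
  Counts.fours c < 5 × Counts.threes c < 9 × Counts.twos c < 3 × Counts.ones c < 3
unreduced?-sound ⟨ i , j , k , m ⟩ unreduced with Equivalence.to (T-∧ {i <ᵇ 5}) unreduced
... | i< , rest with Equivalence.to (T-∧ {j <ᵇ 9}) rest
... | j< , rest′ with Equivalence.to (T-∧ {k <ᵇ 3}) rest′
... | k< , m< = <ᵇ⇒< i 5 i< , <ᵇ⇒< j 9 j< , <ᵇ⇒< k 3 k< , <ᵇ⇒< m 3 m<

module _ {i j k m} (R₄ : Reduction 5 5 i) (R₃ : Reduction 9 4 j) (R₂ : Reduction 3 3 k) (R₁ : Reduction 3 2 m) where
  open Reduction

  private
    r : Counts
    r = ⟨ residue R₄ , residue R₃ , residue R₂ , residue R₁ ⟩

    c≡ : ⟨ i , j , k , m ⟩ ≡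
      ⟨ quotient R₄ * 5 + residue R₄ , quotient R₃ * 4 + residue R₃ , quotient R₂ * 3 + residue R₂ , quotient R₁ * 2 + residue R₁ ⟩
    c≡ = counts-cong (x≡ R₄) (x≡ R₃) (x≡ R₂) (x≡ R₁)

  potential-from-residues : 2 ∣ sum (sequence ⟨ i , j , k , m ⟩) → 5 ≤ i + j → sequence ⟨ i , j , k , m ⟩ ∉ exceptions →
    Potential ⟨ i , j , k , m ⟩
  potential-from-residues even 5≤i+j not-exceptional =
    subst Potential (≡.sym c≡) (periodic (quotient R₄) (quotient R₃) (quotient R₂) (quotient R₁)
      (residue-potential r (box-sound settled? box-settled (residue< R₄) (residue< R₃) (residue< R₂) (residue< R₁))
        admissible unreduced⇒∉))
    where
    even-r : 2 ∣ sum (sequence r)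
    even-r = ∣m+n∣m⇒∣n (subst (2 ∣_) (trans (cong (sum ∘ sequence) c≡)
      (sum-periodic (quotient R₄) (quotient R₃) (quotient R₂) (quotient R₁) (residue R₄) (residue R₃) (residue R₂) (residue R₁)))
      even) (m∣m*n (quotient R₄ * 10 + quotient R₃ * 6 + quotient R₂ * 3 + quotient R₁))
    5≤r : 5 ≤ residue R₄ + residue R₃
    5≤r with unchanged-or-large R₄ | unchanged-or-large R₃
    ... | inj₂ 5≤r₄ | _         = ≤-trans 5≤r₄ (m≤m+n _ _)
    ... | inj₁ _    | inj₂ 9≤r₃ = ≤-trans (m≤n+m 5 4) (≤-trans 9≤r₃ (m≤n+m _ _))
    ... | inj₁ r₄≡i | inj₁ r₃≡j = subst₂ (λ a b → 5 ≤ a + b) (≡.sym r₄≡i) (≡.sym r₃≡j) 5≤i+j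
    admissible : T (admissible? r)
    admissible = Equivalence.from T-∧ (fromWitness even-r , ≤⇒≤ᵇ 5≤r)
    unreduced⇒∉ : T (unreduced? r) → sequence r ∉ exceptions
    unreduced⇒∉ unreduced with unreduced?-sound r unreduced
    ... | i< , j< , k< , m< = subst (_∉ exceptions) (cong sequence (≡.sym (counts-cong
      (residue-unchanged R₄ i<) (residue-unchanged R₃ j<) (residue-unchanged R₂ k<) (residue-unchanged R₁ m<)))) not-exceptional

potential-unless-exceptional : ∀ i j k m → 2 ∣ sum (sequence ⟨ i , j , k , m ⟩) → 5 ≤ i + j →
  sequence ⟨ i , j , k , m ⟩ ∉ exceptions → Potential ⟨ i , j , k , m ⟩
potential-unless-exceptional i j k m = potential-from-residues (reduce 5 5 i) (reduce 9 4 j) (reduce 3 3 k) (reduce 3 2 m)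

exceptions-refuted : all (λ π → noEmbedding? (lookup π)) exceptions ≡ true
exceptions-refuted = refl

exception-not-potential : ∀ {π} → π ∈ exceptions → ¬ PotentiallyK6-C5-Graphic π
exception-not-potential {π} π∈ (G , degrees , f , f-injective , f-edges) = refute (canonical-form f f-injective)
  where
  refuted : T (noEmbedding? (lookup π))
  refuted = All.lookup (all-true⁺ (λ π → noEmbedding? (lookup π)) exceptions exceptions-refuted) π∈
  refute : Σ (Fin 5 × Bool) (λ (m , s) → Canonical (f ∘ dihedral m s)) → ⊥
  refute ((m , s) , canonical) =
    noEmbedding?-sound {G = G} degrees (f ∘ dihedral m s) (injective ∘ f-injective)
      (λ a b ab → f-edges (dihedral m s a) (dihedral m s b) (preserves a b ab)) refuted canonical
    where open Automorphism (dihedral-automorphism m s)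

lemma2p9 : (n i j k : ℕ) → 6 ≤ n → i + j + k + 1 ≤ n → 5 ≤ i + j →
    2 ∣ sum (seqπ n i j k) →
    PotentiallyK6-C5-Graphic (seqπ n i j k) ⇔ (seqπ n i j k ∉ exceptions)
lemma2p9 n i j k _ _ 5≤i+j even = mk⇔
  (λ potentially exceptional → exception-not-potential exceptional potentially)
  (Potential.potentially ∘ potential-unless-exceptional i j k (n ∸ i ∸ j ∸ k ∸ 1) even 5≤i+j)
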